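{- Let $p$ be an odd prime, $F$ the finite field of order $p^n$, $L$ its quadratic extension, and let $s$ be an invertible Niho exponent over $L$ with $s\equiv 1\pmod{p^n-1}$. For $a\in L$ let $K_{a,s}=\{x\in L^\times : \mathrm{Tr}_{L/F}(x^s-ax)=0\}$. Then $|K_{a,s}|$ is a multiple of $p^n-1$ and $$W_{L,s}(a)=p^n\cdot\frac{|K_{a,s}|}{p^n-1}-p^n.$$ In particular $W_{L,s}(a)$ is divisible by $p^n$.
   Context: $\mathrm{Tr}_{L/F}(y)=y+y^{p^n}$ is the relative trace. $\mu(x)=e^{2\pi i\,\mathrm{Tr}_{L/\mathbb{F}_p}(x)/p}$ is the canonical additive character of $L$, and $W_{L,s}(a)=\sum_{x\in L}\mu(x^s-ax)$. The exponent $s$ is invertible over $L$ if $\gcd(s,p^{2n}-1)=1$; it is a Niho exponent if it is not congruent to a power of $p$ modulo $p^{2n}-1$ but $s\equiv p^j\pmod{p^n-1}$ for some $j\ge 0$. -}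

module Defs where

open import Level using (0ℓ)
open import Data.Nat as ℕ using (ℕ; zero; suc)
open import Data.Integer as ℤ using (ℤ; +_)
open import Data.Fin using (Fin; toℕ)
open import Data.List using (List; []; _∷_; length; filter; foldr; map)
open import Data.List.Relation.Unary.Unique.Propositional using (Unique)
open import Data.List.Membership.Propositional using (_∈_)
open import Data.Product using (∃)
open import Relation.Binary.PropositionalEquality using (_≡_; _≢_)
open import Relation.Binary.Definitions using (DecidableEquality)
open import Relation.Nullary using (¬_; yes; no)
open import Relation.Nullary.Decidable using (does)
open import Algebra.Core using (Op₁; Op₂)
open import Algebra.Structures using (IsCommutativeRing)

record FiniteField : Set₁ where
  infixl 6 _+_
  infixl 7 _*_
  field
    Carrier  : Set
    _+_ _*_  : Op₂ Carrier
    -_       : Op₁ Carrier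
    0# 1#    : Carrier
    isCommutativeRing : IsCommutativeRing _≡_ _+_ _*_ -_ 0# 1#
    0≢1      : 0# ≢ 1#
    inverse  : ∀ x → x ≢ 0# → ∃ λ y → x * y ≡ 1#
    _≟_      : DecidableEquality Carrier
    elements : List Carrier
    unique   : Unique elements
    complete : ∀ x → x ∈ elements

  order : ℕ
  order = length elements

  _^_ : Carrier → ℕ → Carrier
  x ^ zero  = 1#
  x ^ suc k = x * (x ^ k)

  fromℕ : ℕ → Carrier
  fromℕ zero    = 0#
  fromℕ (suc k) = 1# + fromℕ k

  HasChar : ℕ → Set
  HasChar p = fromℕ p ≡ 0#

  Σ< : ℕ → (ℕ → Carrier) → Carrier
  Σ< zero    f = 0#
  Σ< (suc k) f = Σ< k f + f k

  -- absolute trace to the prime field F_p, for |L| = p^m: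
  -- Tr(x) = x + x^p + ... + x^(p^(m-1))
  absTr : (p m : ℕ) → Carrier → Carrier
  absTr p m x = Σ< m (λ i → x ^ (p ℕ.^ i))

  -- relative trace Tr_{L/F}(y) = y + y^(p^n)   (F = subfield of order p^n)
  relTr : (p n : ℕ) → Carrier → Carrier
  relTr p n y = y + y ^ (p ℕ.^ n)

  Kset : (p n s : ℕ) → Carrier → List Carrier
  Kset p n s a = filter (λ x → ¬? (x ≟ 0#) ×-dec (relTr p n (x ^ s + - (a * x)) ≟ 0#)) elements
    where
    open import Relation.Nullary.Decidable using (¬?; _×-dec_)

-- The cyclotomic integers ℤ[ζ_p], ζ_p = e^{2πi/p}, realised as
-- ℤ[x]/(x^p - 1, Φ_p(x)): an element is a coefficient vector Fin p → ℤ
-- (the coefficient of ζ^c), and two vectors are equal iff their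
-- difference is a constant vector (i.e. a multiple of 1 + ζ + ... + ζ^(p-1)).

Cyc : ℕ → Set
Cyc p = Fin p → ℤ

_≈ᶜ_ : ∀ {p} → Cyc p → Cyc p → Set
_≈ᶜ_ {p} v w = ∃ λ (k : ℤ) → ∀ (c : Fin p) → v c ℤ.- w c ≡ k

0ᶜ : ∀ {p} → Cyc p
0ᶜ c = + 0

_+ᶜ_ : ∀ {p} → Cyc p → Cyc p → Cyc p
(v +ᶜ w) c = v c ℤ.+ w c

intᶜ : ∀ {p} → ℤ → Cyc p
intᶜ m c with toℕ c
... | zero  = m
... | suc _ = + 0

module _ (L : FiniteField) where
  open FiniteField L

  -- the canonical additive character μ(x) = ζ_p^{Tr(x)}, where |L| = p^m:
  -- the coefficient of ζ^c is 1 iff Tr(x) = c in F_p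
  μ : (p m : ℕ) → Carrier → Cyc p
  μ p m x c with absTr p m x ≟ fromℕ (toℕ c)
  ... | yes _ = + 1
  ... | no  _ = + 0

  W : (p n s : ℕ) → Carrier → Cyc p
  W p n s a = foldr (λ x acc → μ p (2 ℕ.* n) (x ^ s + - (a * x)) +ᶜ acc) 0ᶜ elements

_≡_[mod_] : ℕ → ℕ → ℕ → Set
a ≡ b [mod m ] = (+ m) ∣ ((+ a) ℤ.- (+ b))
  where open import Data.Integer.Divisibility using (_∣_)

{-# OPTIONS --safe #-}
-- Write q = p^n, F for the subfield of order q and T(x) = Tr_{L/F}(x^s - a x).  Since s ≡ 1
-- (mod q - 1), every λ ∈ F has λ^s = λ, so T(λ x) = λ T(x): the fibre sizes N(t) of T equal
-- N(1) on F^×, vanish off F (T takes values in F), and N(0) = 1 + |K_{a,s}|.  Counting L gives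
-- q² = 1 + |K_{a,s}| + (q - 1) N(1), i.e. |K_{a,s}| = k (q - 1) with k = q + 1 - N(1).
-- As Tr_{L/𝔽_p} = Tr_{F/𝔽_p} ∘ Tr_{L/F}, the coefficient of ζ^c in W_{L,s}(a) is the sum of
-- N(t) over t ∈ F with Tr_{F/𝔽_p}(t) = c; since Tr_{F/𝔽_p} takes every value equally often on F,
-- all coefficients agree except that of ζ^0, which exceeds them by N(0) - N(1) = q k - q.
-- The finite-field facts used (|F| = q, Tr_{F/𝔽_p} ≢ 0) come from the root bound for the
-- polynomials X^q ± X and X + X^p + ⋯ + X^(p^(n-1)) together with |Tr_{L/F}⁻¹(t)| ≤ q.
module Submission where

open import Defs
open import Data.Nat using (ℕ; _^_; _*_; _∸_; _≥_; _>_)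
open import Data.Nat.Primality using (Prime)
open import Data.Nat.GCD using (gcd)
open import Data.Integer using (+_; _-_)
open import Data.List using (length)
open import Data.Product using (∃; _×_)
open import Relation.Binary.PropositionalEquality using (_≡_)
open import Relation.Nullary using (¬_)

open import Algebra.Bundles using (CommutativeRing; CommutativeSemigroup)
open import Algebra.Core using (Op₂)
open import Algebra.Structures using (IsCommutativeMonoid)
open import Data.Bool using (if_then_else_)
open import Data.Empty using (⊥-elim)
open import Data.Fin as Fin using (Fin; toℕ)
open import Data.Integer as ℤ using (ℤ)
open import Data.List using (List; []; _∷_; foldr; filter)
open import Data.List.Membership.Propositional using (_∈_)
open import Data.List.Relation.Unary.All as All using (All; []; _∷_)
open import Data.List.Relation.Unary.Any using (here; there)
open import Data.List.Relation.Unary.AllPairs using (_∷_)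
open import Data.List.Relation.Unary.Unique.Propositional using (Unique)
open import Data.Nat as ℕ using (zero; suc; _≤_; _<_; z≤n; s≤s)
open import Data.Nat.Combinatorics using (_C_; nCn≡1; nC1≡n; nCk+nC[k+1]≡[n+1]C[k+1])
open import Data.Nat.Divisibility using (_∣_; divides; ∣⇒≤)
open import Data.Nat.Coprimality using (prime⇒coprime; coprime-Bézout)
open import Data.Nat.GCD using (module Bézout)
open import Data.Nat.Primality using (euclidsLemma; prime⇒nonZero)
open import Data.Product using (_,_; proj₁; proj₂)
open import Data.Sum using (_⊎_; inj₁; inj₂)
open import Function.Bundles using (_⇔_; mk⇔)
open import Relation.Binary.Definitions using (DecidableEquality)
open import Relation.Binary.PropositionalEquality using (_≢_; refl; sym; trans; cong; cong₂; subst; module ≡-Reasoning)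
open import Relation.Nullary using (Dec; yes; no; does)
open import Relation.Nullary.Decidable using (¬?; _×-dec_; does-⇔)
import Data.List.Relation.Unary.All.Properties as All
import Data.List.Relation.Unary.Unique.Propositional.Properties as Unique
import Data.Fin.Properties as Finₚ
import Data.Nat.Properties as ℕ
open import Data.Nat.Tactic.RingSolver using (solve-∀)
import Data.Integer.Tactic.RingSolver as ℤ-Solver

[k+1]*[n+1]C[k+1]≡[n+1]*nCk : ∀ n k → suc k * (suc n C suc k) ≡ suc n * (n C k)
[k+1]*[n+1]C[k+1]≡[n+1]*nCk zero    zero    = refl
[k+1]*[n+1]C[k+1]≡[n+1]*nCk zero    (suc k) = ℕ.*-zeroʳ (suc (suc k))
[k+1]*[n+1]C[k+1]≡[n+1]*nCk (suc n) zero    =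
  trans (ℕ.*-identityˡ _) (trans (nC1≡n (suc (suc n))) (sym (ℕ.*-identityʳ _)))
[k+1]*[n+1]C[k+1]≡[n+1]*nCk (suc n) (suc k) = begin
  suc (suc k) * (suc (suc n) C suc (suc k))        ≡⟨ cong (suc (suc k) *_) (sym (pascal (suc n) (suc k))) ⟩
  suc (suc k) * (c ℕ.+ d)                            ≡⟨ expand k c d ⟩
  suc k * c ℕ.+ c ℕ.+ suc (suc k) * d                ≡⟨ cong₂ (λ u v → u ℕ.+ c ℕ.+ v)
                                                          ([k+1]*[n+1]C[k+1]≡[n+1]*nCk n k)
                                                          ([k+1]*[n+1]C[k+1]≡[n+1]*nCk n (suc k)) ⟩
  suc n * (n C k) ℕ.+ c ℕ.+ suc n * (n C suc k)      ≡⟨ collect n (n C k) (n C suc k) c ⟩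
  suc n * (n C k ℕ.+ n C suc k) ℕ.+ c                ≡⟨ cong (λ u → suc n * u ℕ.+ c) (pascal n k) ⟩
  suc n * c ℕ.+ c                                    ≡⟨ ℕ.+-comm (suc n * c) c ⟩
  suc (suc n) * c                                    ∎
  where
  open ≡-Reasoning
  pascal = nCk+nC[k+1]≡[n+1]C[k+1]
  c = suc n C suc k
  d = suc n C suc (suc k)
  expand : ∀ k c d → suc (suc k) * (c ℕ.+ d) ≡ suc k * c ℕ.+ c ℕ.+ suc (suc k) * d
  expand = solve-∀
  collect : ∀ n a b c → suc n * a ℕ.+ c ℕ.+ suc n * b ≡ suc n * (a ℕ.+ b) ℕ.+ c
  collect = solve-∀

prime∣pCk : ∀ {p k} → Prime p → 0 < k → k < p → p ∣ p C k
prime∣pCk {suc p} {suc k} p-prime _ k<p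
  with euclidsLemma (suc k) (suc p C suc k) p-prime
         (divides (p C k) (trans ([k+1]*[n+1]C[k+1]≡[n+1]*nCk p k) (ℕ.*-comm (suc p) _)))
... | inj₁ p∣k+1 = ⊥-elim (ℕ.<⇒≱ k<p (∣⇒≤ p∣k+1))
... | inj₂ p∣pCk = p∣pCk

module ListSum {M : Set} {_∙_ : Op₂ M} {ε : M} (isCM : IsCommutativeMonoid _≡_ _∙_ ε) where
  open IsCommutativeMonoid isCM using (identityˡ; identityʳ; isCommutativeSemigroup)

  private
    commutativeSemigroup : CommutativeSemigroup _ _
    commutativeSemigroup = record { isCommutativeSemigroup = isCommutativeSemigroup }

  open import Algebra.Properties.CommutativeSemigroup commutativeSemigroup using (interchange)
  open ≡-Reasoning

  ∑ : {X : Set} → List X → (X → M) → M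
  ∑ xs f = foldr (λ x acc → f x ∙ acc) ε xs

  infix 8 _when_
  _when_ : {P : Set} → M → Dec P → M
  a when d = if does d then a else ε

  when-yes : ∀ {P : Set} a (d : Dec P) → P → a when d ≡ a
  when-yes a (yes _) _  = refl
  when-yes a (no ¬p) p  = ⊥-elim (¬p p)

  when-no : ∀ {P : Set} a (d : Dec P) → ¬ P → a when d ≡ ε
  when-no a (yes p) ¬p = ⊥-elim (¬p p)
  when-no a (no _)  _  = refl

  when-∙-when-¬ : ∀ {P : Set} a (d : Dec P) → (a when d) ∙ (a when ¬? d) ≡ a
  when-∙-when-¬ a (yes _) = identityʳ a
  when-∙-when-¬ a (no _)  = identityˡ a

  when-⇔ : ∀ {P Q : Set} a (d : Dec P) (e : Dec Q) → P ⇔ Q → a when d ≡ a when e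
  when-⇔ a d e P⇔Q = cong (λ b → if b then a else ε) (does-⇔ P⇔Q d e)

  module _ {X : Set} where

    ∑-cong : ∀ (xs : List X) {f g} → (∀ x → f x ≡ g x) → ∑ xs f ≡ ∑ xs g
    ∑-cong []       f≗g = refl
    ∑-cong (x ∷ xs) f≗g = cong₂ _∙_ (f≗g x) (∑-cong xs f≗g)

    ∑-distrib : ∀ (xs : List X) f g → ∑ xs (λ x → f x ∙ g x) ≡ ∑ xs f ∙ ∑ xs g
    ∑-distrib []       f g = sym (identityˡ ε)
    ∑-distrib (x ∷ xs) f g = trans (cong ((f x ∙ g x) ∙_) (∑-distrib xs f g)) (interchange _ _ _ _)

    ∑-ε : ∀ (xs : List X) → ∑ xs (λ _ → ε) ≡ ε
    ∑-ε []       = refl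
    ∑-ε (x ∷ xs) = trans (cong (ε ∙_) (∑-ε xs)) (identityˡ ε)

  ∑-comm : ∀ {X Y : Set} (xs : List X) (ys : List Y) (F : X → Y → M) →
           ∑ xs (λ x → ∑ ys (F x)) ≡ ∑ ys (λ y → ∑ xs (λ x → F x y))
  ∑-comm []       ys F = sym (∑-ε ys)
  ∑-comm (x ∷ xs) ys F = trans (cong (∑ ys (F x) ∙_) (∑-comm xs ys F)) (sym (∑-distrib ys (F x) _))

  module _ {X : Set} (_≟_ : DecidableEquality X) where

    ∑-when-≡ : ∀ (xs : List X) → Unique xs → ∀ {v} (f : X → M) → v ∈ xs →
               ∑ xs (λ x → f x when (x ≟ v)) ≡ f v
    ∑-when-≡ (x ∷ xs) (x∉xs ∷ _) f (here refl) with x ≟ x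
    ... | yes _  = trans (cong (f x ∙_) (absent xs x∉xs)) (identityʳ (f x))
      where
      absent : ∀ ys → All (x ≢_) ys → ∑ ys (λ y → f y when (y ≟ x)) ≡ ε
      absent []       []            = refl
      absent (y ∷ ys) (x≢y ∷ x∉ys) with y ≟ x
      ... | yes y≡x = ⊥-elim (x≢y (sym y≡x))
      ... | no  _   = trans (identityˡ _) (absent ys x∉ys)
    ... | no x≢x = ⊥-elim (x≢x refl)
    ∑-when-≡ (x ∷ xs) (x∉xs ∷ xs!) {v} f (there v∈xs) with x ≟ v
    ... | yes refl = ⊥-elim (All.lookup x∉xs v∈xs refl)
    ... | no  _    = trans (identityˡ _) (∑-when-≡ xs xs! f v∈xs)

    module _ (E : List X) (E! : Unique E) (E-complete : ∀ x → x ∈ E) where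

      ∑-reindex : ∀ (g h : X → X) → (∀ x → h (g x) ≡ x) → (∀ x → g (h x) ≡ x) →
                  ∀ f → ∑ E (λ x → f (g x)) ≡ ∑ E f
      ∑-reindex g h hg≗id gh≗id f = begin
        ∑ E (λ x → f (g x))
          ≡⟨ ∑-cong E (λ x → sym (pick f (g x))) ⟩
        ∑ E (λ x → ∑ E (λ t → f t when (t ≟ g x)))
          ≡⟨ ∑-comm E E _ ⟩
        ∑ E (λ t → ∑ E (λ x → f t when (t ≟ g x)))
          ≡⟨ ∑-cong E (λ t → ∑-cong E (λ x →
            when-⇔ (f t) (t ≟ g x) (x ≟ h t) (mk⇔
              (λ t≡gx → trans (sym (hg≗id x)) (cong h (sym t≡gx)))
              (λ x≡ht → trans (sym (gh≗id t)) (cong g (sym x≡ht)))))) ⟩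
        ∑ E (λ t → ∑ E (λ x → f t when (x ≟ h t)))
          ≡⟨ ∑-cong E (λ t → pick (λ _ → f t) (h t)) ⟩
        ∑ E f                                                   ∎
        where
        pick : ∀ (f : X → M) v → ∑ E (λ x → f x when (x ≟ v)) ≡ f v
        pick f v = ∑-when-≡ E E! f (E-complete v)

open ListSum ℕ.+-0-isCommutativeMonoid

module _ {X : Set} where

  ∑-mono-≤ : ∀ (xs : List X) {f g : X → ℕ} → (∀ x → f x ≤ g x) → ∑ xs f ≤ ∑ xs g
  ∑-mono-≤ []       f≤g = z≤n
  ∑-mono-≤ (x ∷ xs) f≤g = ℕ.+-mono-≤ (f≤g x) (∑-mono-≤ xs f≤g)

  *-distribˡ-∑ : ∀ (xs : List X) k (f : X → ℕ) → k * ∑ xs f ≡ ∑ xs (λ x → k * f x)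
  *-distribˡ-∑ []       k f = ℕ.*-zeroʳ k
  *-distribˡ-∑ (x ∷ xs) k f = trans (ℕ.*-distribˡ-+ k (f x) _) (cong (k * f x ℕ.+_) (*-distribˡ-∑ xs k f))

  ∑-1≡length : ∀ (xs : List X) → ∑ xs (λ _ → 1) ≡ length xs
  ∑-1≡length []       = refl
  ∑-1≡length (x ∷ xs) = cong suc (∑-1≡length xs)

  module _ {P : X → Set} (P? : ∀ x → Dec (P x)) where

    ∑-1-when≡length-filter : ∀ xs → ∑ xs (λ x → 1 when P? x) ≡ length (filter P? xs)
    ∑-1-when≡length-filter []       = refl
    ∑-1-when≡length-filter (x ∷ xs) with P? x
    ... | yes _ = cong suc (∑-1-when≡length-filter xs)
    ... | no  _ = ∑-1-when≡length-filter xs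

    ∑-1-when≢0⇒∃ : ∀ xs → ∑ xs (λ x → 1 when P? x) ≢ 0 → ∃ P
    ∑-1-when≢0⇒∃ []       ∑≢0 = ⊥-elim (∑≢0 refl)
    ∑-1-when≢0⇒∃ (x ∷ xs) ∑≢0 with P? x
    ... | yes px = x , px
    ... | no  _  = ∑-1-when≢0⇒∃ xs ∑≢0

when≡*1-when : ∀ {P : Set} a (d : Dec P) → a when d ≡ a * (1 when d)
when≡*1-when a (yes _) = sym (ℕ.*-identityʳ a)
when≡*1-when a (no _)  = sym (ℕ.*-zeroʳ a)

*-distrib-when : ∀ {P : Set} v a (d : Dec P) b e → v * (a when d ℕ.+ b * e) ≡ (v * a) when d ℕ.+ b * (v * e)
*-distrib-when v a (yes _) b e = distrib v a b e
  where
  distrib : ∀ v a b e → v * (a ℕ.+ b * e) ≡ v * a ℕ.+ b * (v * e)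
  distrib = solve-∀
*-distrib-when v a (no _)  b e = swap v b e
  where
  swap : ∀ v b e → v * (b * e) ≡ b * (v * e)
  swap = solve-∀

module _ {P Q : Set} where

  1-when-×-dec : ∀ (d : Dec P) (e : Dec Q) → 1 when (d ×-dec e) ≡ (1 when d) * (1 when e)
  1-when-×-dec (yes _) (yes _) = refl
  1-when-×-dec (yes _) (no _)  = refl
  1-when-×-dec (no _)  _       = refl

  1-when-split : ∀ (d : Dec P) (e : Dec Q) → 1 when d ≡ 1 when (d ×-dec e) ℕ.+ 1 when (d ×-dec ¬? e)
  1-when-split (yes _) (yes _) = refl
  1-when-split (yes _) (no _)  = refl
  1-when-split (no _)  _       = refl

  1-when-×-dec≤ : ∀ (d : Dec P) (e : Dec Q) → 1 when (d ×-dec e) ≤ 1 when e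
  1-when-×-dec≤ (yes _) _       = ℕ.≤-refl
  1-when-×-dec≤ (no _)  _       = z≤n


module FieldProperties (L : FiniteField) where
  open FiniteField L public renaming (_*_ to _·_; _^_ to _^ᶠ_)

  ring : CommutativeRing _ _
  ring = record { isCommutativeRing = isCommutativeRing }

  open CommutativeRing ring public
    using ( +-assoc; +-comm; +-identityˡ; +-identityʳ; -‿inverseˡ; -‿inverseʳ
          ; *-assoc; *-comm; *-identityˡ; *-identityʳ; distribˡ; distribʳ; zeroˡ; zeroʳ)
  open CommutativeRing ring public using (commutativeSemiring; semiring)
  open CommutativeRing ring using (+-monoid; +-group)
  open import Algebra.Properties.Ring (CommutativeRing.ring ring) public using (-‿distribˡ-*; -‿distribʳ-*)
  open import Algebra.Properties.Group +-group public
    using (x∙y⁻¹≈ε⇒x≈y) renaming (∙-cancelˡ to +-cancelˡ; ∙-cancelʳ to +-cancelʳ)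
  open import Algebra.Solver.Ring.NaturalCoefficients.Default commutativeSemiring public
  open import Algebra.Properties.CommutativeSemiring.Exp commutativeSemiring
    using (^-homo-*; ^-assocʳ; ^-distrib-*) renaming (_^_ to _^ₛ_)
  open import Algebra.Properties.Monoid.Mult +-monoid using () renaming (_×_ to _×ₘ_)
  open import Algebra.Properties.Semiring.Mult semiring using (×1-homo-*; ×-assoc-*)
  open import Algebra.Properties.Semiring.Sum semiring using (sum; sum-init-last; sum-cong-≗; sum-replicate-zero)
  open import Algebra.Properties.CommutativeSemiring.Binomial commutativeSemiring using (theorem; binomialTerm)
  open ≡-Reasoning

  ^ᶠ≡^ₛ : ∀ x n → x ^ᶠ n ≡ x ^ₛ n
  ^ᶠ≡^ₛ x zero    = refl
  ^ᶠ≡^ₛ x (suc n) = cong (x ·_) (^ᶠ≡^ₛ x n)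

  ^-+ : ∀ x m n → x ^ᶠ (m ℕ.+ n) ≡ x ^ᶠ m · x ^ᶠ n
  ^-+ x m n = begin
    x ^ᶠ (m ℕ.+ n)  ≡⟨ ^ᶠ≡^ₛ x (m ℕ.+ n) ⟩
    x ^ₛ (m ℕ.+ n)  ≡⟨ ^-homo-* x m n ⟩
    x ^ₛ m · x ^ₛ n ≡⟨ sym (cong₂ _·_ (^ᶠ≡^ₛ x m) (^ᶠ≡^ₛ x n)) ⟩
    x ^ᶠ m · x ^ᶠ n ∎

  ^-* : ∀ x m n → x ^ᶠ (m * n) ≡ (x ^ᶠ m) ^ᶠ n
  ^-* x m n = begin
    x ^ᶠ (m * n)    ≡⟨ ^ᶠ≡^ₛ x (m * n) ⟩
    x ^ₛ (m * n)    ≡⟨ sym (^-assocʳ x m n) ⟩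
    (x ^ₛ m) ^ₛ n   ≡⟨ sym (trans (^ᶠ≡^ₛ (x ^ᶠ m) n) (cong (_^ₛ n) (^ᶠ≡^ₛ x m))) ⟩
    (x ^ᶠ m) ^ᶠ n   ∎

  ^-distrib-· : ∀ x y n → (x · y) ^ᶠ n ≡ x ^ᶠ n · y ^ᶠ n
  ^-distrib-· x y n = begin
    (x · y) ^ᶠ n    ≡⟨ ^ᶠ≡^ₛ (x · y) n ⟩
    (x · y) ^ₛ n    ≡⟨ ^-distrib-* x y n ⟩
    x ^ₛ n · y ^ₛ n ≡⟨ sym (cong₂ _·_ (^ᶠ≡^ₛ x n) (^ᶠ≡^ₛ y n)) ⟩
    x ^ᶠ n · y ^ᶠ n ∎

  0^n≡0 : ∀ n → .{{ℕ.NonZero n}} → 0# ^ᶠ n ≡ 0#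
  0^n≡0 (suc n) = zeroˡ _

  ^-periodic : ∀ {x} m → x ^ᶠ suc m ≡ x → ∀ j → x ^ᶠ suc (j * m) ≡ x
  ^-periodic {x} m x^[1+m]≡x zero    = *-identityʳ x
  ^-periodic {x} m x^[1+m]≡x (suc j) =
    trans (^-+ x (suc m) (j * m)) (trans (cong (_· x ^ᶠ (j * m)) x^[1+m]≡x) (^-periodic m x^[1+m]≡x j))

  1^n≡1 : ∀ n → 1# ^ᶠ n ≡ 1#
  1^n≡1 zero    = refl
  1^n≡1 (suc n) = trans (*-identityˡ _) (1^n≡1 n)

  fromℕ≡×1 : ∀ m → fromℕ m ≡ m ×ₘ 1#
  fromℕ≡×1 zero    = refl
  fromℕ≡×1 (suc m) = cong (_+_ 1#) (fromℕ≡×1 m)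

  fromℕ-* : ∀ m n → fromℕ (m * n) ≡ fromℕ m · fromℕ n
  fromℕ-* m n = trans (fromℕ≡×1 (m * n))
    (trans (×1-homo-* m n) (sym (cong₂ _·_ (fromℕ≡×1 m) (fromℕ≡×1 n))))

  x-y≡0⇒x≡y : ∀ {x y} → x + - y ≡ 0# → x ≡ y
  x-y≡0⇒x≡y = x∙y⁻¹≈ε⇒x≈y _ _

  [x-r]+r≡x : ∀ x r → x + - r + r ≡ x
  [x-r]+r≡x x r = trans (+-assoc x (- r) r) (trans (cong (_+_ x) (-‿inverseˡ r)) (+-identityʳ x))

  [x+r]-r≡x : ∀ x r → x + r + - r ≡ x
  [x+r]-r≡x x r = trans (+-assoc x r (- r)) (trans (cong (_+_ x) (-‿inverseʳ r)) (+-identityʳ x))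

  1≢0 : 1# ≢ 0#
  1≢0 1≡0 = 0≢1 (sym 1≡0)

  infix 30 _⁻¹⟨_⟩
  _⁻¹⟨_⟩ : ∀ x → x ≢ 0# → Carrier
  x ⁻¹⟨ x≢0 ⟩ = proj₁ (inverse x x≢0)

  ·-inverseʳ : ∀ x (x≢0 : x ≢ 0#) → x · x ⁻¹⟨ x≢0 ⟩ ≡ 1#
  ·-inverseʳ x x≢0 = proj₂ (inverse x x≢0)

  ·-inverseˡ : ∀ x (x≢0 : x ≢ 0#) → x ⁻¹⟨ x≢0 ⟩ · x ≡ 1#
  ·-inverseˡ x x≢0 = trans (*-comm _ x) (·-inverseʳ x x≢0)

  x⁻¹·[x·y]≡y : ∀ x (x≢0 : x ≢ 0#) y → x ⁻¹⟨ x≢0 ⟩ · (x · y) ≡ y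
  x⁻¹·[x·y]≡y x x≢0 y = trans (sym (*-assoc _ x y)) (trans (cong (_· y) (·-inverseˡ x x≢0)) (*-identityˡ y))

  x·[x⁻¹·y]≡y : ∀ x (x≢0 : x ≢ 0#) y → x · (x ⁻¹⟨ x≢0 ⟩ · y) ≡ y
  x·[x⁻¹·y]≡y x x≢0 y = trans (sym (*-assoc x _ y)) (trans (cong (_· y) (·-inverseʳ x x≢0)) (*-identityˡ y))

  ·-cancelˡ : ∀ {x y z} → x ≢ 0# → x · y ≡ x · z → y ≡ z
  ·-cancelˡ {x} {y} {z} x≢0 xy≡xz = begin
    y                       ≡⟨ sym (*-identityˡ y) ⟩
    1# · y                  ≡⟨ cong (_· y) (sym (·-inverseˡ x x≢0)) ⟩
    x ⁻¹⟨ x≢0 ⟩ · x · y     ≡⟨ *-assoc _ x y ⟩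
    x ⁻¹⟨ x≢0 ⟩ · (x · y)   ≡⟨ cong (x ⁻¹⟨ x≢0 ⟩ ·_) xy≡xz ⟩
    x ⁻¹⟨ x≢0 ⟩ · (x · z)   ≡⟨ sym (*-assoc _ x z) ⟩
    x ⁻¹⟨ x≢0 ⟩ · x · z     ≡⟨ cong (_· z) (·-inverseˡ x x≢0) ⟩
    1# · z                  ≡⟨ *-identityˡ z ⟩
    z                       ∎

  fixed-⁻¹ : ∀ k {x} (x≢0 : x ≢ 0#) → x ^ᶠ k ≡ x → x ⁻¹⟨ x≢0 ⟩ ^ᶠ k ≡ x ⁻¹⟨ x≢0 ⟩
  fixed-⁻¹ k {x} x≢0 x^k≡x = ·-cancelˡ x≢0 (begin
    x · x⁻¹ ^ᶠ k         ≡⟨ cong (_· x⁻¹ ^ᶠ k) (sym x^k≡x) ⟩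
    x ^ᶠ k · x⁻¹ ^ᶠ k    ≡⟨ sym (^-distrib-· x x⁻¹ k) ⟩
    (x · x⁻¹) ^ᶠ k       ≡⟨ cong (_^ᶠ k) (·-inverseʳ x x≢0) ⟩
    1# ^ᶠ k              ≡⟨ 1^n≡1 k ⟩
    1#                   ≡⟨ sym (·-inverseʳ x x≢0) ⟩
    x · x⁻¹              ∎)
    where x⁻¹ = x ⁻¹⟨ x≢0 ⟩

  x·y≡0⇒x≡0⊎y≡0 : ∀ {x y} → x · y ≡ 0# → x ≡ 0# ⊎ y ≡ 0#
  x·y≡0⇒x≡0⊎y≡0 {x} {y} xy≡0 with x ≟ 0#
  ... | yes x≡0 = inj₁ x≡0
  ... | no  x≢0 = inj₂ (·-cancelˡ x≢0 (trans xy≡0 (sym (zeroʳ x))))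

  x≢0∧y≢0⇒x·y≢0 : ∀ {x y} → x ≢ 0# → y ≢ 0# → x · y ≢ 0#
  x≢0∧y≢0⇒x·y≢0 x≢0 y≢0 xy≡0 with x·y≡0⇒x≡0⊎y≡0 xy≡0
  ... | inj₁ x≡0 = x≢0 x≡0
  ... | inj₂ y≡0 = y≢0 y≡0

  ×ₘ≡fromℕ· : ∀ m z → m ×ₘ z ≡ fromℕ m · z
  ×ₘ≡fromℕ· m z = begin
    m ×ₘ z            ≡⟨ cong (m ×ₘ_) (sym (*-identityˡ z)) ⟩
    m ×ₘ (1# · z)     ≡⟨ sym (×-assoc-* m 1# z) ⟩
    (m ×ₘ 1#) · z     ≡⟨ cong (_· z) (sym (fromℕ≡×1 m)) ⟩
    fromℕ m · z       ∎

  fromℕ-*-≡0 : ∀ c m → fromℕ m ≡ 0# → fromℕ (c * m) ≡ 0#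
  fromℕ-*-≡0 c m m≡0 = trans (fromℕ-* c m) (trans (cong (fromℕ c ·_) m≡0) (zeroʳ _))

  fromℕ-multiple≡0 : ∀ {p} → HasChar p → ∀ {m} → p ∣ m → fromℕ m ≡ 0#
  fromℕ-multiple≡0 {p} char-p (divides c refl) = fromℕ-*-≡0 c p char-p

  fromℕ≡0⇒fromℕ[1+k]≡1 : ∀ k → fromℕ k ≡ 0# → fromℕ (suc k) ≡ 1#
  fromℕ≡0⇒fromℕ[1+k]≡1 k k≡0 = trans (cong (_+_ 1#) k≡0) (+-identityʳ 1#)

  fromℕ≢0 : ∀ {p m} → Prime p → HasChar p → .{{_ : ℕ.NonZero m}} → m < p → fromℕ m ≢ 0#
  fromℕ≢0 {p} {m} p-prime char-p m<p m≡0 with coprime-Bézout (prime⇒coprime p-prime m<p)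
  ... | Bézout.+- x y 1+ym≡xp = 1≢0 (begin
    1#                   ≡⟨ sym (fromℕ≡0⇒fromℕ[1+k]≡1 (y * m) (fromℕ-*-≡0 y m m≡0)) ⟩
    fromℕ (suc (y * m))  ≡⟨ cong fromℕ 1+ym≡xp ⟩
    fromℕ (x * p)        ≡⟨ fromℕ-*-≡0 x p char-p ⟩
    0#                   ∎)
  ... | Bézout.-+ x y 1+xp≡ym = 1≢0 (begin
    1#                   ≡⟨ sym (fromℕ≡0⇒fromℕ[1+k]≡1 (x * p) (fromℕ-*-≡0 x p char-p)) ⟩
    fromℕ (suc (x * p))  ≡⟨ cong fromℕ 1+xp≡ym ⟩
    fromℕ (y * m)        ≡⟨ fromℕ-*-≡0 y m m≡0 ⟩
    0#                   ∎)

  -- In characteristic p the binomial coefficients p C k with 0 < k < p vanish.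
  ^p-+ : ∀ {p} → Prime p → HasChar p → ∀ x y → (x + y) ^ᶠ p ≡ x ^ᶠ p + y ^ᶠ p
  ^p-+ {p@(suc (suc m))} p-prime char-p x y = begin
    (x + y) ^ᶠ p
      ≡⟨ ^ᶠ≡^ₛ (x + y) p ⟩
    (x + y) ^ₛ p
      ≡⟨ theorem p x y ⟩
    term Fin.zero + sum (λ i → term (Fin.suc i))
      ≡⟨ cong (_+_ (term Fin.zero)) (sum-init-last (λ i → term (Fin.suc i))) ⟩
    term Fin.zero + (sum inner + term (Fin.fromℕ p))
      ≡⟨ cong (λ u → term Fin.zero + (u + term (Fin.fromℕ p))) inner≡0 ⟩
    term Fin.zero + (0# + term (Fin.fromℕ p))
      ≡⟨ cong₂ (λ u v → u + (0# + v)) first last ⟩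
    y ^ᶠ p + (0# + x ^ᶠ p)
      ≡⟨ solve 2 (λ x y → y :+ (con 0 :+ x) := x :+ y) refl (x ^ᶠ p) (y ^ᶠ p) ⟩
    x ^ᶠ p + y ^ᶠ p                                    ∎
    where
    term = binomialTerm x y p
    inner = λ (i : Fin (suc m)) → term (Fin.suc (Fin.inject₁ i))
    first : term Fin.zero ≡ y ^ᶠ p
    first = trans (+-identityʳ _) (trans (*-identityˡ _) (sym (^ᶠ≡^ₛ y p)))
    last : term (Fin.fromℕ p) ≡ x ^ᶠ p
    last = begin
      term (Fin.fromℕ p)                       ≡⟨ cong (λ k → (p C k) ×ₘ (x ^ₛ k · y ^ₛ (p ∸ k))) (Finₚ.toℕ-fromℕ p) ⟩
      (p C p) ×ₘ (x ^ₛ p · y ^ₛ (p ∸ p))       ≡⟨ cong₂ (λ c k → c ×ₘ (x ^ₛ p · y ^ₛ k)) (nCn≡1 p) (ℕ.n∸n≡0 p) ⟩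
      x ^ₛ p · 1# + 0#                         ≡⟨ trans (+-identityʳ _) (*-identityʳ _) ⟩
      x ^ₛ p                                   ≡⟨ sym (^ᶠ≡^ₛ x p) ⟩
      x ^ᶠ p                                   ∎
    inner≡0 : sum inner ≡ 0#
    inner≡0 = trans (sum-cong-≗ vanish) (sum-replicate-zero (suc m))
      where
      vanish : ∀ i → inner i ≡ 0#
      vanish i = begin
        inner i                     ≡⟨ ×ₘ≡fromℕ· (p C suc k) b ⟩
        fromℕ (p C suc k) · b       ≡⟨ cong (_· b) (fromℕ-multiple≡0 char-p (prime∣pCk p-prime (s≤s z≤n) k+1<p)) ⟩
        0# · b                      ≡⟨ zeroˡ b ⟩
        0#                          ∎
        where
        k = toℕ (Fin.inject₁ i)
        b = x ^ₛ suc k · y ^ₛ (p ∸ suc k)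
        k+1<p : suc k < p
        k+1<p = s≤s (subst (_< suc m) (sym (Finₚ.toℕ-inject₁ i)) (Finₚ.toℕ<n i))

  Σ<-cong : ∀ k {f g} → (∀ i → i < k → f i ≡ g i) → Σ< k f ≡ Σ< k g
  Σ<-cong zero    f≗g = refl
  Σ<-cong (suc k) f≗g = cong₂ _+_ (Σ<-cong k (λ i i<k → f≗g i (ℕ.m<n⇒m<1+n i<k))) (f≗g k ℕ.≤-refl)

  Σ<-zero : ∀ k {f} → (∀ i → i < k → f i ≡ 0#) → Σ< k f ≡ 0#
  Σ<-zero zero    f≗0 = refl
  Σ<-zero (suc k) f≗0 = trans (cong₂ _+_ (Σ<-zero k (λ i i<k → f≗0 i (ℕ.m<n⇒m<1+n i<k))) (f≗0 k ℕ.≤-refl))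
                              (+-identityˡ 0#)

  Σ<-distrib : ∀ k f g → Σ< k (λ i → f i + g i) ≡ Σ< k f + Σ< k g
  Σ<-distrib zero    f g = sym (+-identityˡ 0#)
  Σ<-distrib (suc k) f g = trans (cong (_+ (f k + g k)) (Σ<-distrib k f g))
    (solve 4 (λ a b c d → (a :+ b) :+ (c :+ d) := (a :+ c) :+ (b :+ d)) refl (Σ< k f) (Σ< k g) (f k) (g k))

  ·-distribˡ-Σ< : ∀ k c f → c · Σ< k f ≡ Σ< k (λ i → c · f i)
  ·-distribˡ-Σ< zero    c f = zeroʳ c
  ·-distribˡ-Σ< (suc k) c f = trans (distribˡ c _ _) (cong (_+ (c · f k)) (·-distribˡ-Σ< k c f))

  Σ<-suc : ∀ k f → Σ< (suc k) f ≡ f 0 + Σ< k (λ i → f (suc i))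
  Σ<-suc zero    f = trans (+-identityˡ _) (sym (+-identityʳ _))
  Σ<-suc (suc k) f = trans (cong (_+ f (suc k)) (Σ<-suc k f)) (+-assoc _ _ _)

  Σ<-+ : ∀ m k f → Σ< (m ℕ.+ k) f ≡ Σ< m f + Σ< k (λ i → f (m ℕ.+ i))
  Σ<-+ m zero    f = trans (cong (λ t → Σ< t f) (ℕ.+-identityʳ m)) (sym (+-identityʳ _))
  Σ<-+ m (suc k) f = begin
    Σ< (m ℕ.+ suc k) f                                      ≡⟨ cong (λ t → Σ< t f) (ℕ.+-suc m k) ⟩
    Σ< (m ℕ.+ k) f + f (m ℕ.+ k)                            ≡⟨ cong (_+ f (m ℕ.+ k)) (Σ<-+ m k f) ⟩
    Σ< m f + Σ< k (λ i → f (m ℕ.+ i)) + f (m ℕ.+ k)         ≡⟨ +-assoc _ _ _ ⟩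
    Σ< m f + Σ< (suc k) (λ i → f (m ℕ.+ i))                 ∎

  Σ<-comm : ∀ a b (F : ℕ → ℕ → Carrier) → Σ< a (λ j → Σ< b (F j)) ≡ Σ< b (λ i → Σ< a (λ j → F j i))
  Σ<-comm zero    b F = sym (Σ<-zero b (λ _ _ → refl))
  Σ<-comm (suc a) b F = trans (cong (_+ Σ< b (F a)) (Σ<-comm a b F)) (sym (Σ<-distrib b _ _))

module Frobenius (L : FiniteField) {p : ℕ} (p-prime : Prime p) (char-p : FiniteField.HasChar L p) where
  open FieldProperties L
  open ≡-Reasoning

  instance
    p≢0 : ℕ.NonZero p
    p≢0 = prime⇒nonZero p-prime

  ^p^-+ : ∀ i x y → (x + y) ^ᶠ (p ^ i) ≡ x ^ᶠ (p ^ i) + y ^ᶠ (p ^ i)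
  ^p^-+ zero    x y = trans (*-identityʳ _) (sym (cong₂ _+_ (*-identityʳ x) (*-identityʳ y)))
  ^p^-+ (suc i) x y = begin
    (x + y) ^ᶠ (p * p ^ i)                       ≡⟨ ^-* (x + y) p (p ^ i) ⟩
    ((x + y) ^ᶠ p) ^ᶠ (p ^ i)                    ≡⟨ cong (_^ᶠ (p ^ i)) (^p-+ p-prime char-p x y) ⟩
    (x ^ᶠ p + y ^ᶠ p) ^ᶠ (p ^ i)                 ≡⟨ ^p^-+ i (x ^ᶠ p) (y ^ᶠ p) ⟩
    (x ^ᶠ p) ^ᶠ (p ^ i) + (y ^ᶠ p) ^ᶠ (p ^ i)    ≡⟨ sym (cong₂ _+_ (^-* x p (p ^ i)) (^-* y p (p ^ i))) ⟩
    x ^ᶠ (p * p ^ i) + y ^ᶠ (p * p ^ i)          ∎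

  ^p^-^p^ : ∀ x i j → (x ^ᶠ (p ^ i)) ^ᶠ (p ^ j) ≡ x ^ᶠ (p ^ (i ℕ.+ j))
  ^p^-^p^ x i j = trans (sym (^-* x (p ^ i) (p ^ j))) (cong (x ^ᶠ_) (sym (ℕ.^-distribˡ-+-* p i j)))

  0^p^ : ∀ i → 0# ^ᶠ (p ^ i) ≡ 0#
  0^p^ i = 0^n≡0 (p ^ i) {{ℕ.m^n≢0 p i}}

  fromℕ^p : ∀ c → fromℕ c ^ᶠ p ≡ fromℕ c
  fromℕ^p zero    = 0^n≡0 p
  fromℕ^p (suc c) = trans (^p-+ p-prime char-p 1# (fromℕ c)) (cong₂ _+_ (1^n≡1 p) (fromℕ^p c))

  ^p≡⇒^p^≡ : ∀ {z} → z ^ᶠ p ≡ z → ∀ i → z ^ᶠ (p ^ i) ≡ z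
  ^p≡⇒^p^≡ {z} z^p≡z zero    = *-identityʳ z
  ^p≡⇒^p^≡ {z} z^p≡z (suc i) = trans (^-* z p (p ^ i)) (trans (cong (_^ᶠ (p ^ i)) z^p≡z) (^p≡⇒^p^≡ z^p≡z i))

  Σ<-^p^ : ∀ j k f → (Σ< k f) ^ᶠ (p ^ j) ≡ Σ< k (λ i → f i ^ᶠ (p ^ j))
  Σ<-^p^ j zero    f = 0^p^ j
  Σ<-^p^ j (suc k) f = trans (^p^-+ j _ _) (cong (_+ (f k ^ᶠ (p ^ j))) (Σ<-^p^ j k f))

  absTr-+ : ∀ m x y → absTr p m (x + y) ≡ absTr p m x + absTr p m y
  absTr-+ m x y = trans (Σ<-cong m (λ i _ → ^p^-+ i x y)) (Σ<-distrib m _ _)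

  absTr-0 : ∀ m → absTr p m 0# ≡ 0#
  absTr-0 m = Σ<-zero m (λ i _ → 0^p^ i)

  absTr-· : ∀ m {c} → c ^ᶠ p ≡ c → ∀ x → absTr p m (c · x) ≡ c · absTr p m x
  absTr-· m {c} c^p≡c x = trans (Σ<-cong m (λ i _ → trans (^-distrib-· c x (p ^ i)) (cong (_· _) (^p≡⇒^p^≡ c^p≡c i))))
                                (sym (·-distribˡ-Σ< m c _))

  absTr-relTr : ∀ n z → absTr p (2 * n) z ≡ absTr p n (relTr p n z)
  absTr-relTr n z = begin
    Σ< (n ℕ.+ (n ℕ.+ 0)) f
      ≡⟨ cong (λ t → Σ< (n ℕ.+ t) f) (ℕ.+-identityʳ n) ⟩
    Σ< (n ℕ.+ n) f
      ≡⟨ Σ<-+ n n f ⟩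
    Σ< n f + Σ< n (λ i → f (n ℕ.+ i))
      ≡⟨ cong (_+_ (Σ< n f)) (Σ<-cong n (λ i _ → sym (^p^-^p^ z n i))) ⟩
    Σ< n f + Σ< n (λ i → (z ^ᶠ (p ^ n)) ^ᶠ (p ^ i))
      ≡⟨ sym (Σ<-distrib n _ _) ⟩
    Σ< n (λ i → f i + (z ^ᶠ (p ^ n)) ^ᶠ (p ^ i))
      ≡⟨ Σ<-cong n (λ i _ → sym (^p^-+ i z _)) ⟩
    absTr p n (relTr p n z)                                        ∎
    where f = λ i → z ^ᶠ (p ^ i)

  -- Frobenius permutes the terms z, z^p, …, z^(p^(n-1)) cyclically when z^(p^n) = z.
  absTr^p : ∀ n t → t ^ᶠ (p ^ n) ≡ t → absTr p n t ^ᶠ p ≡ absTr p n t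
  absTr^p n t t^pⁿ≡t = begin
    absTr p n t ^ᶠ p
      ≡⟨ cong (absTr p n t ^ᶠ_) (sym (ℕ.*-identityʳ p)) ⟩
    absTr p n t ^ᶠ (p ^ 1)
      ≡⟨ Σ<-^p^ 1 n f ⟩
    Σ< n (λ i → f i ^ᶠ (p ^ 1))
      ≡⟨ Σ<-cong n (λ i _ → trans (^p^-^p^ t i 1) (cong (λ u → t ^ᶠ (p ^ u)) (ℕ.+-comm i 1))) ⟩
    Σ< n (λ i → f (suc i))
      ≡⟨ +-cancelˡ (f 0) _ _ shifted ⟩
    absTr p n t                             ∎
    where
    f = λ i → t ^ᶠ (p ^ i)
    shifted : f 0 + Σ< n (λ i → f (suc i)) ≡ f 0 + Σ< n f
    shifted = begin
      f 0 + Σ< n (λ i → f (suc i))   ≡⟨ sym (Σ<-suc n f) ⟩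
      Σ< n f + f n                   ≡⟨ cong (_+_ (Σ< n f)) (trans t^pⁿ≡t (sym (*-identityʳ t))) ⟩
      Σ< n f + f 0                   ≡⟨ +-comm _ _ ⟩
      f 0 + Σ< n f                   ∎

module RootBound (L : FiniteField) where
  open FieldProperties L
  open ≡-Reasoning

  -- Dense polynomials of formal degree d, constant coefficient first.
  data Poly : ℕ → Set where
    lead : Carrier → Poly 0
    _∷ₚ_ : ∀ {d} → Carrier → Poly d → Poly (suc d)

  eval : ∀ {d} → Poly d → Carrier → Carrier
  eval (lead c)  x = c
  eval (c ∷ₚ P) x = c + x · eval P x

  leading : ∀ {d} → Poly d → Carrier
  leading (lead c)  = c
  leading (c ∷ₚ P) = leading P

  -- Synthetic division by X - r.
  quotient : ∀ {d} → Poly (suc d) → Carrier → Poly d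
  quotient (c ∷ₚ lead c′)       r = lead c′
  quotient (c ∷ₚ (c′ ∷ₚ P))    r = eval (c′ ∷ₚ P) r ∷ₚ quotient (c′ ∷ₚ P) r

  leading-quotient : ∀ {d} (P : Poly (suc d)) r → leading (quotient P r) ≡ leading P
  leading-quotient (c ∷ₚ lead c′)    r = refl
  leading-quotient (c ∷ₚ (c′ ∷ₚ P)) r = leading-quotient (c′ ∷ₚ P) r

  eval-quotient : ∀ {d} (P : Poly (suc d)) r x → eval P x ≡ eval P r + (x + - r) · eval (quotient P r) x
  eval-quotient (c ∷ₚ lead c′) r x = begin
    c + x · c′
      ≡⟨ cong (λ t → c + t · c′) (sym ([x-r]+r≡x x r)) ⟩
    c + (x + - r + r) · c′
      ≡⟨ solve 4 (λ c c′ d r → c :+ (d :+ r) :* c′ := (c :+ r :* c′) :+ d :* c′) refl c c′ (x + - r) r ⟩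
    c + r · c′ + (x + - r) · c′ ∎
  eval-quotient (c ∷ₚ (c′ ∷ₚ P)) r x = begin
    c + x · eval H x
      ≡⟨ cong (λ t → c + x · t) (eval-quotient H r x) ⟩
    c + x · (Hr + d · Q)
      ≡⟨ cong (λ t → c + t · (Hr + d · Q)) (sym ([x-r]+r≡x x r)) ⟩
    c + (d + r) · (Hr + d · Q)
      ≡⟨ solve 5 (λ c d r Hr Q → c :+ (d :+ r) :* (Hr :+ d :* Q)
        := (c :+ r :* Hr) :+ d :* (Hr :+ (d :+ r) :* Q)) refl c d r Hr Q ⟩
    c + r · Hr + d · (Hr + (d + r) · Q)
      ≡⟨ cong (λ t → c + r · Hr + d · (Hr + t · Q)) ([x-r]+r≡x x r) ⟩
    c + r · Hr + d · (Hr + x · Q)                 ∎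
    where
    H  = c′ ∷ₚ P
    d  = x + - r
    Hr = eval H r
    Q  = eval (quotient H r) x

  roots≤degree : ∀ {d} (P : Poly d) → leading P ≢ 0# → (rs : List Carrier) → Unique rs →
                 All (λ r → eval P r ≡ 0#) rs → length rs ≤ d
  roots≤degree P        _    []       _               _               = z≤n
  roots≤degree (lead c) c≢0 (r ∷ rs) _               (c≡0 ∷ _)       = ⊥-elim (c≢0 c≡0)
  roots≤degree (c ∷ₚ P) P≢0 (r ∷ rs) (r∉rs ∷ rs!) (Pr≡0 ∷ Prs≡0) =
    s≤s (roots≤degree Q (λ Q≡0 → P≢0 (trans (sym (leading-quotient (c ∷ₚ P) r)) Q≡0))
                      rs rs! (All.zipWith root-of-quotient (r∉rs , Prs≡0)))
    where
    Q = quotient (c ∷ₚ P) r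
    root-of-quotient : ∀ {r′} → (r ≢ r′) × (eval (c ∷ₚ P) r′ ≡ 0#) → eval Q r′ ≡ 0#
    root-of-quotient {r′} (r≢r′ , Pr′≡0)
      with x·y≡0⇒x≡0⊎y≡0 (begin
             (r′ + - r) · eval Q r′                    ≡⟨ sym (+-identityˡ _) ⟩
             0# + (r′ + - r) · eval Q r′               ≡⟨ cong (_+ ((r′ + - r) · eval Q r′)) (sym Pr≡0) ⟩
             eval (c ∷ₚ P) r + (r′ + - r) · eval Q r′  ≡⟨ sym (eval-quotient (c ∷ₚ P) r r′) ⟩
             eval (c ∷ₚ P) r′                          ≡⟨ Pr′≡0 ⟩
             0#                                        ∎)
    ... | inj₁ r′-r≡0 = ⊥-elim (r≢r′ (sym (x-y≡0⇒x≡y r′-r≡0)))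
    ... | inj₂ Qr′≡0  = Qr′≡0

  fromCoefficients : ∀ d → (ℕ → Carrier) → Poly d
  fromCoefficients zero    g = lead (g 0)
  fromCoefficients (suc d) g = g 0 ∷ₚ fromCoefficients d (λ j → g (suc j))

  leading-fromCoefficients : ∀ d g → leading (fromCoefficients d g) ≡ g d
  leading-fromCoefficients zero    g = refl
  leading-fromCoefficients (suc d) g = leading-fromCoefficients d (λ j → g (suc j))

  eval-fromCoefficients : ∀ d g x → eval (fromCoefficients d g) x ≡ Σ< (suc d) (λ j → g j · x ^ᶠ j)
  eval-fromCoefficients zero    g x = sym (trans (+-identityˡ _) (*-identityʳ _))
  eval-fromCoefficients (suc d) g x = begin
    g 0 + x · eval (fromCoefficients d (λ j → g (suc j))) x
      ≡⟨ cong (λ t → g 0 + x · t) (eval-fromCoefficients d _ x) ⟩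
    g 0 + x · Σ< (suc d) (λ j → g (suc j) · x ^ᶠ j)
      ≡⟨ cong (_+_ (g 0)) (·-distribˡ-Σ< (suc d) x _) ⟩
    g 0 + Σ< (suc d) (λ j → x · (g (suc j) · x ^ᶠ j))
      ≡⟨ cong₂ _+_ (sym (*-identityʳ (g 0)))
        (Σ<-cong (suc d) (λ j _ → solve 3 (λ x a b → x :* (a :* b) := a :* (x :* b))
          refl x (g (suc j)) (x ^ᶠ j))) ⟩
    g 0 · x ^ᶠ 0 + Σ< (suc d) (λ j → g (suc j) · x ^ᶠ suc j) ≡⟨ sym (Σ<-suc (suc d) (λ j → g j · x ^ᶠ j)) ⟩
    Σ< (suc (suc d)) (λ j → g j · x ^ᶠ j)                    ∎

  #roots≤degree : ∀ d (g : ℕ → Carrier) → g d ≢ 0# → (rs : List Carrier) → Unique rs →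
                  All (λ r → Σ< (suc d) (λ j → g j · r ^ᶠ j) ≡ 0#) rs → length rs ≤ d
  #roots≤degree d g gd≢0 rs rs! roots =
    roots≤degree (fromCoefficients d g) (λ lead≡0 → gd≢0 (trans (sym (leading-fromCoefficients d g)) lead≡0)) rs rs!
                 (All.map (trans (eval-fromCoefficients d g _)) roots)

  δ : ℕ → ℕ → Carrier
  δ m j with j ℕ.≟ m
  ... | yes _ = 1#
  ... | no  _ = 0#

  δ-≡ : ∀ m → δ m m ≡ 1#
  δ-≡ m with m ℕ.≟ m
  ... | yes _   = refl
  ... | no  m≢m = ⊥-elim (m≢m refl)

  δ-≢ : ∀ {m j} → j ≢ m → δ m j ≡ 0#
  δ-≢ {m} {j} j≢m with j ℕ.≟ m
  ... | yes j≡m = ⊥-elim (j≢m j≡m)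
  ... | no  _   = refl

  Σ<-δ : ∀ k m (h : ℕ → Carrier) → m < k → Σ< k (λ j → δ m j · h j) ≡ h m
  Σ<-δ (suc k) m h m<1+k with ℕ.m<1+n⇒m<n∨m≡n m<1+k
  ... | inj₂ refl = begin
    Σ< k (λ j → δ k j · h j) + δ k k · h k
      ≡⟨ cong₂ _+_ (Σ<-zero k (λ j j<k → trans (cong (_· h j) (δ-≢ (ℕ.<⇒≢ j<k))) (zeroˡ _)))
        (trans (cong (_· h k) (δ-≡ k)) (*-identityˡ _)) ⟩
    0# + h k
      ≡⟨ +-identityˡ _ ⟩
    h k                                      ∎
  ... | inj₁ m<k = begin
    Σ< k (λ j → δ m j · h j) + δ m k · h k
      ≡⟨ cong₂ _+_ (Σ<-δ k m h m<k) (trans (cong (_· h k) (δ-≢ (ℕ.>⇒≢ m<k))) (zeroˡ _)) ⟩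
    h m + 0#
      ≡⟨ +-identityʳ _ ⟩
    h m                                      ∎

  X^q+cX : ℕ → Carrier → ℕ → Carrier
  X^q+cX q c j = δ q j + c · δ 1 j

  eval-X^q+cX : ∀ {q} → 1 < q → ∀ c x → Σ< (suc q) (λ j → X^q+cX q c j · x ^ᶠ j) ≡ x ^ᶠ q + c · x
  eval-X^q+cX {q} 1<q c x = begin
    Σ< (suc q) (λ j → (δ q j + c · δ 1 j) · x ^ᶠ j)
      ≡⟨ Σ<-cong (suc q) (λ j _ → trans (distribʳ _ _ _)
        (cong (_+_ (δ q j · x ^ᶠ j)) (*-assoc _ _ _))) ⟩
    Σ< (suc q) (λ j → δ q j · x ^ᶠ j + c · (δ 1 j · x ^ᶠ j))
      ≡⟨ Σ<-distrib (suc q) _ _ ⟩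
    Σ< (suc q) (λ j → δ q j · x ^ᶠ j) + Σ< (suc q) (λ j → c · (δ 1 j · x ^ᶠ j)) ≡⟨ cong₂ _+_ (Σ<-δ (suc q) q _ ℕ.≤-refl)
        (sym (·-distribˡ-Σ< (suc q) c _)) ⟩
    x ^ᶠ q + c · Σ< (suc q) (λ j → δ 1 j · x ^ᶠ j)
      ≡⟨ cong (λ t → x ^ᶠ q + c · t)
        (trans (Σ<-δ (suc q) 1 _ (ℕ.m<n⇒m<1+n 1<q)) (*-identityʳ x)) ⟩
    x ^ᶠ q + c · x                                                            ∎

  X^q+cX-leading : ∀ {q} → 1 < q → ∀ c → X^q+cX q c q ≡ 1#
  X^q+cX-leading {q} 1<q c = trans (cong₂ _+_ (δ-≡ q) (trans (cong (c ·_) (δ-≢ (ℕ.>⇒≢ 1<q))) (zeroʳ c))) (+-identityʳ 1#)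

  traceCoefficients : ℕ → ℕ → ℕ → Carrier
  traceCoefficients p m j = Σ< m (λ i → δ (p ^ i) j)

  eval-trace : ∀ {p} → 1 < p → ∀ m x →
    Σ< (suc (p ^ m)) (λ j → traceCoefficients p (suc m) j · x ^ᶠ j) ≡ absTr p (suc m) x
  eval-trace {p} 1<p m x = begin
    Σ< (suc (p ^ m)) (λ j → Σ< (suc m) (λ i → δ (p ^ i) j) · x ^ᶠ j)
      ≡⟨ Σ<-cong (suc (p ^ m)) (λ j _ → trans (*-comm _ _) (·-distribˡ-Σ< (suc m) (x ^ᶠ j) _)) ⟩
    Σ< (suc (p ^ m)) (λ j → Σ< (suc m) (λ i → x ^ᶠ j · δ (p ^ i) j))
      ≡⟨ Σ<-comm (suc (p ^ m)) (suc m) _ ⟩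
    Σ< (suc m) (λ i → Σ< (suc (p ^ m)) (λ j → x ^ᶠ j · δ (p ^ i) j))
      ≡⟨ Σ<-cong (suc m) (λ i i≤m → trans (Σ<-cong (suc (p ^ m)) (λ j _ → *-comm _ _))
        (Σ<-δ (suc (p ^ m)) (p ^ i) (x ^ᶠ_) (s≤s (ℕ.^-monoʳ-≤ p {{p≢0}} (ℕ.≤-pred i≤m))))) ⟩
    absTr p (suc m) x                                                    ∎
    where p≢0 = ℕ.>-nonZero (ℕ.<-trans (s≤s z≤n) 1<p)

  traceCoefficients-leading : ∀ {p} → 1 < p → ∀ m → traceCoefficients p (suc m) (p ^ m) ≡ 1#
  traceCoefficients-leading {p} 1<p m =
    trans (cong₂ _+_ (Σ<-zero m (λ i i<m → δ-≢ (ℕ.>⇒≢ (ℕ.^-monoʳ-< p 1<p i<m)))) (δ-≡ (p ^ m))) (+-identityˡ 1#)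

module Counting (L : FiniteField) where
  open FieldProperties L
  open RootBound L using (#roots≤degree)
  open ≡-Reasoning
  open ListSum (CommutativeRing.*-isCommutativeMonoid ring)
    using ()
    renaming ( ∑ to ∏; _when_ to _when·_; when-no to when·-no
             ; ∑-cong to ∏-cong; ∑-distrib to ∏-distrib; ∑-reindex to ∏-reindex)

  #[_] : ∀ {P : Carrier → Set} → (∀ x → Dec (P x)) → ℕ
  #[ P? ] = ∑ elements (λ x → 1 when P? x)

  ∑-reindexᴸ : ∀ (g h : Carrier → Carrier) → (∀ x → h (g x) ≡ x) → (∀ x → g (h x) ≡ x) →
               ∀ f → ∑ elements (λ x → f (g x)) ≡ ∑ elements f
  ∑-reindexᴸ = ∑-reindex _≟_ elements unique complete

  ∑-when-≡ᴸ : ∀ v (f : Carrier → ℕ) → ∑ elements (λ x → f x when (x ≟ v)) ≡ f v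
  ∑-when-≡ᴸ v f = ∑-when-≡ _≟_ elements unique f (complete v)

  ∑-translate : ∀ t₀ f → ∑ elements (λ x → f (x + t₀)) ≡ ∑ elements f
  ∑-translate t₀ = ∑-reindexᴸ (_+ t₀) (_+ - t₀) (λ x → [x+r]-r≡x x t₀) (λ x → [x-r]+r≡x x t₀)

  ∑-scale : ∀ {c} (c≢0 : c ≢ 0#) f → ∑ elements (λ x → f (c · x)) ≡ ∑ elements f
  ∑-scale {c} c≢0 = ∑-reindexᴸ (c ·_) (c ⁻¹⟨ c≢0 ⟩ ·_) (x⁻¹·[x·y]≡y c c≢0) (x·[x⁻¹·y]≡y c c≢0)

  #roots≤ : ∀ d (g : ℕ → Carrier) → g d ≢ 0# → ∀ {P : Carrier → Set} (P? : ∀ x → Dec (P x)) →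
            (∀ x → P x → Σ< (suc d) (λ j → g j · x ^ᶠ j) ≡ 0#) → #[ P? ] ≤ d
  #roots≤ d g gd≢0 P? roots = subst (_≤ d) (sym (∑-1-when≡length-filter P? elements))
    (#roots≤degree d g gd≢0 (filter P? elements) (Unique.filter⁺ P? unique)
                   (All.map (roots _) (All.all-filter P? elements)))

  #fibre : (Carrier → Carrier) → Carrier → ℕ
  #fibre g t = ∑ elements (λ x → 1 when (t ≟ g x))

  ∑-fibres : ∀ (w : Carrier → ℕ) g → ∑ elements (λ x → w (g x)) ≡ ∑ elements (λ t → w t * #fibre g t)
  ∑-fibres w g = begin
    ∑ elements (λ x → w (g x))
      ≡⟨ ∑-cong elements (λ x → sym (∑-when-≡ᴸ (g x) w)) ⟩
    ∑ elements (λ x → ∑ elements (λ t → w t when (t ≟ g x)))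
      ≡⟨ ∑-comm elements elements _ ⟩
    ∑ elements (λ t → ∑ elements (λ x → w t when (t ≟ g x)))
      ≡⟨ ∑-cong elements (λ t → trans
        (∑-cong elements (λ x → when≡*1-when (w t) (t ≟ g x)))
        (sym (*-distribˡ-∑ elements (w t) (λ x → 1 when (t ≟ g x))))) ⟩
    ∑ elements (λ t → w t * #fibre g t)                       ∎

  ∑-#fibre≡order : ∀ g → ∑ elements (#fibre g) ≡ order
  ∑-#fibre≡order g = begin
    ∑ elements (#fibre g)                    ≡⟨ ∑-cong elements (λ t → sym (ℕ.*-identityˡ _)) ⟩
    ∑ elements (λ t → 1 * #fibre g t)        ≡⟨ sym (∑-fibres (λ _ → 1) g) ⟩
    ∑ elements (λ _ → 1)                     ≡⟨ ∑-1≡length elements ⟩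
    order                                    ∎

  nonzero? : ∀ y → Dec (y ≢ 0#)
  nonzero? y = ¬? (y ≟ 0#)

  suc-#nonzero≡order : suc #[ nonzero? ] ≡ order
  suc-#nonzero≡order = begin
    suc #[ nonzero? ]
      ≡⟨ cong (ℕ._+ #[ nonzero? ]) (sym (∑-when-≡ᴸ 0# (λ _ → 1))) ⟩
    ∑ elements (λ y → 1 when (y ≟ 0#)) ℕ.+ #[ nonzero? ]
      ≡⟨ sym (∑-distrib elements _ _) ⟩
    ∑ elements (λ y → 1 when (y ≟ 0#) ℕ.+ 1 when nonzero? y)
      ≡⟨ ∑-cong elements (λ y → when-∙-when-¬ 1 (y ≟ 0#)) ⟩
    ∑ elements (λ _ → 1)
      ≡⟨ ∑-1≡length elements ⟩
    order                                                              ∎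

  nonzeroPart : Carrier → Carrier
  nonzeroPart y = y when· nonzero? y

  ∏nonzeroPart≢0 : ∀ ys → ∏ ys nonzeroPart ≢ 0#
  ∏nonzeroPart≢0 []       = 1≢0
  ∏nonzeroPart≢0 (y ∷ ys) = x≢0∧y≢0⇒x·y≢0 (nonzeroPart≢0 y) (∏nonzeroPart≢0 ys)
    where
    nonzeroPart≢0 : ∀ y → nonzeroPart y ≢ 0#
    nonzeroPart≢0 y with y ≟ 0#
    ... | yes _   = 1≢0
    ... | no  y≢0 = y≢0

  nonzeroPart-· : ∀ {x} → x ≢ 0# → ∀ y → nonzeroPart (x · y) ≡ (x when· nonzero? y) · nonzeroPart y
  nonzeroPart-· {x} x≢0 y with y ≟ 0#
  ... | yes refl = trans (cong nonzeroPart (zeroʳ x))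
                         (trans (when·-no 0# (nonzero? 0#) (λ 0≢0 → 0≢0 refl)) (sym (*-identityˡ 1#)))
  ... | no  y≢0 with (x · y) ≟ 0#
  ...   | yes xy≡0 = ⊥-elim (x≢0∧y≢0⇒x·y≢0 x≢0 y≢0 xy≡0)
  ...   | no  _    = refl

  ∏-when·-nonzero : ∀ x ys → ∏ ys (λ y → x when· nonzero? y) ≡ x ^ᶠ ∑ ys (λ y → 1 when nonzero? y)
  ∏-when·-nonzero x []       = refl
  ∏-when·-nonzero x (y ∷ ys) with y ≟ 0#
  ... | yes _ = trans (*-identityˡ _) (∏-when·-nonzero x ys)
  ... | no  _ = cong (x ·_) (∏-when·-nonzero x ys)

  -- Multiplication by x permutes the nonzero elements, so it fixes their product.
  x^#nonzero≡1 : ∀ {x} → x ≢ 0# → x ^ᶠ #[ nonzero? ] ≡ 1#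
  x^#nonzero≡1 {x} x≢0 = ·-cancelˡ (∏nonzeroPart≢0 elements) (begin
    P · x ^ᶠ #[ nonzero? ]
      ≡⟨ *-comm P _ ⟩
    x ^ᶠ #[ nonzero? ] · P
      ≡⟨ cong (_· P) (sym (∏-when·-nonzero x elements)) ⟩
    ∏ elements (λ y → x when· nonzero? y) · P
      ≡⟨ sym (∏-distrib elements _ _) ⟩
    ∏ elements (λ y → (x when· nonzero? y) · nonzeroPart y) ≡⟨ sym (∏-cong elements (nonzeroPart-· x≢0)) ⟩
    ∏ elements (λ y → nonzeroPart (x · y))
      ≡⟨ ∏-reindex _≟_ elements unique complete (x ·_) (x ⁻¹⟨ x≢0 ⟩ ·_)
        (x⁻¹·[x·y]≡y x x≢0) (x·[x⁻¹·y]≡y x x≢0) nonzeroPart ⟩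
    P
      ≡⟨ sym (*-identityʳ P) ⟩
    P · 1#                                                 ∎)
    where P = ∏ elements nonzeroPart

  x^order≡x : ∀ x → x ^ᶠ order ≡ x
  x^order≡x x with x ≟ 0#
  ... | yes refl = trans (cong (0# ^ᶠ_) (sym suc-#nonzero≡order)) (zeroˡ _)
  ... | no  x≢0  = begin
    x ^ᶠ order              ≡⟨ cong (x ^ᶠ_) (sym suc-#nonzero≡order) ⟩
    x · x ^ᶠ #[ nonzero? ]  ≡⟨ cong (x ·_) (x^#nonzero≡1 x≢0) ⟩
    x · 1#                  ≡⟨ *-identityʳ x ⟩
    x                       ∎

module QuadraticExtension (L : FiniteField) {p n : ℕ} (p-prime : Prime p) (p>2 : p > 2) (n≥1 : n ≥ 1)
                          (char-p : FiniteField.HasChar L p) (|L|≡p^2n : FiniteField.order L ≡ p ^ (2 * n)) where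
  open FieldProperties L
  open Frobenius L p-prime char-p
  open RootBound L using (X^q+cX; eval-X^q+cX; X^q+cX-leading; traceCoefficients; eval-trace; traceCoefficients-leading)
  open Counting L

  q : ℕ
  q = p ^ n

  q-1 : ℕ
  q-1 = q ∸ 1

  1<p : 1 < p
  1<p = ℕ.<-trans (ℕ.n<1+n 1) p>2

  2<q : 2 < q
  2<q = ℕ.<-≤-trans p>2 (subst (_≤ q) (ℕ.*-identityʳ p) (ℕ.^-monoʳ-≤ p n≥1))

  1<q : 1 < q
  1<q = ℕ.<-trans (ℕ.n<1+n 1) 2<q

  instance
    q≢0 : ℕ.NonZero q
    q≢0 = ℕ.>-nonZero (ℕ.<-trans (s≤s z≤n) 1<q)

  q≡1+[q-1] : q ≡ suc q-1
  q≡1+[q-1] = trans (sym (ℕ.m∸n+n≡m (ℕ.<⇒≤ 1<q))) (ℕ.+-comm q-1 1)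

  order≡q*q : order ≡ q * q
  order≡q*q = trans |L|≡p^2n (trans (cong (λ m → p ^ (n ℕ.+ m)) (ℕ.+-identityʳ n)) (ℕ.^-distribˡ-+-* p n n))

  [x^q]^q≡x : ∀ x → (x ^ᶠ q) ^ᶠ q ≡ x
  [x^q]^q≡x x = trans (sym (^-* x q q)) (trans (cong (x ^ᶠ_) (sym order≡q*q)) (x^order≡x x))

  -- F is represented by its membership test x ^ q ≡ x.
  inF? : ∀ x → Dec (x ^ᶠ q ≡ x)
  inF? x = (x ^ᶠ q) ≟ x

  inF×? : ∀ x → Dec (x ≢ 0# × x ^ᶠ q ≡ x)
  inF×? x = nonzero? x ×-dec inF? x

  ker? : ∀ x → Dec (x ^ᶠ q + x ≡ 0#)
  ker? x = (x ^ᶠ q + x) ≟ 0#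

  relTr-inF : ∀ y → relTr p n y ^ᶠ q ≡ relTr p n y
  relTr-inF y = trans (^p^-+ n y (y ^ᶠ q)) (trans (cong (_+_ (y ^ᶠ q)) ([x^q]^q≡x y)) (+-comm _ _))

  relTr-+ : ∀ x y → relTr p n (x + y) ≡ relTr p n x + relTr p n y
  relTr-+ x y = trans (cong (_+_ (x + y)) (^p^-+ n x y))
    (solve 4 (λ x y a b → (x :+ y) :+ (a :+ b) := (x :+ a) :+ (y :+ b)) refl x y (x ^ᶠ q) (y ^ᶠ q))

  #F≤q : #[ inF? ] ≤ q
  #F≤q = #roots≤ q (X^q+cX q (- 1#)) (λ lead≡0 → 1≢0 (trans (sym (X^q+cX-leading 1<q (- 1#))) lead≡0)) inF?
    (λ x x^q≡x → trans (eval-X^q+cX 1<q (- 1#) x) (begin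
      x ^ᶠ q + - 1# · x   ≡⟨ cong₂ _+_ x^q≡x (sym (-‿distribˡ-* 1# x)) ⟩
      x + - (1# · x)      ≡⟨ cong (λ u → x + - u) (*-identityˡ x) ⟩
      x + - x             ≡⟨ -‿inverseʳ x ⟩
      0#                  ∎))
    where open ≡-Reasoning

  #ker≤q : #[ ker? ] ≤ q
  #ker≤q = #roots≤ q (X^q+cX q 1#) (λ lead≡0 → 1≢0 (trans (sym (X^q+cX-leading 1<q 1#)) lead≡0)) ker?
    (λ x x^q+x≡0 → trans (eval-X^q+cX 1<q 1# x) (trans (cong (_+_ (x ^ᶠ q)) (*-identityˡ x)) x^q+x≡0))

  relTr-fibre⇔ker : ∀ {t x₀} → t ≡ relTr p n x₀ → ∀ x → (t ≡ relTr p n (x + x₀)) ⇔ (x ^ᶠ q + x ≡ 0#)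
  relTr-fibre⇔ker {t} {x₀} t≡Tx₀ x = mk⇔
    (λ t≡T[x+x₀] → +-cancelʳ t _ _ (begin
      x ^ᶠ q + x + t                ≡⟨ cong₂ _+_ (+-comm _ _) t≡Tx₀ ⟩
      relTr p n x + relTr p n x₀    ≡⟨ sym (relTr-+ x x₀) ⟩
      relTr p n (x + x₀)            ≡⟨ sym t≡T[x+x₀] ⟩
      t                             ≡⟨ sym (+-identityˡ t) ⟩
      0# + t                        ∎))
    (λ x∈ker → begin
      t                             ≡⟨ sym (+-identityˡ t) ⟩
      0# + t                        ≡⟨ cong₂ _+_ (trans (sym x∈ker) (+-comm _ _)) t≡Tx₀ ⟩
      relTr p n x + relTr p n x₀    ≡⟨ sym (relTr-+ x x₀) ⟩
      relTr p n (x + x₀)            ∎)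
    where open ≡-Reasoning

  #fibre-relTr≤ : ∀ t → #fibre (relTr p n) t ≤ #[ ker? ] * (1 when inF? t)
  #fibre-relTr≤ t with inF? t
  ... | no t∉F = ℕ.≤-reflexive (trans (∑-cong elements (λ x → when-no 1 (t ≟ relTr p n x)
                     (λ t≡Tx → t∉F (trans (cong (_^ᶠ q) t≡Tx) (trans (relTr-inF x) (sym t≡Tx))))))
                     (trans (∑-ε elements) (sym (ℕ.*-zeroʳ #[ ker? ]))))
  ... | yes _ with #fibre (relTr p n) t ℕ.≟ 0
  ...   | yes #≡0 = subst (_≤ #[ ker? ] * 1) (sym #≡0) z≤n
  ...   | no  #≢0 with ∑-1-when≢0⇒∃ (λ x → t ≟ relTr p n x) elements #≢0
  ...     | x₀ , t≡Tx₀ = ℕ.≤-reflexive (begin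
    #fibre (relTr p n) t
      ≡⟨ sym (∑-translate x₀ _) ⟩
    ∑ elements (λ x → 1 when (t ≟ relTr p n (x + x₀)))
      ≡⟨ ∑-cong elements (λ x → when-⇔ 1 (t ≟ relTr p n (x + x₀)) (ker? x) (relTr-fibre⇔ker t≡Tx₀ x)) ⟩
    #[ ker? ]
      ≡⟨ sym (ℕ.*-identityʳ #[ ker? ]) ⟩
    #[ ker? ] * 1                                          ∎)
    where open ≡-Reasoning

  -- relTr : L → F has fibres of size at most q, so |F| ≥ q² / q.
  #F≡q : #[ inF? ] ≡ q
  #F≡q = ℕ.≤-antisym #F≤q (ℕ.*-cancelˡ-≤ q (begin
    q * q                                              ≡˘⟨ order≡q*q ⟩
    order                                              ≡˘⟨ ∑-#fibre≡order (relTr p n) ⟩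
    ∑ elements (#fibre (relTr p n))                    ≤⟨ ∑-mono-≤ elements #fibre-relTr≤ ⟩
    ∑ elements (λ t → #[ ker? ] * (1 when inF? t))     ≡˘⟨ *-distribˡ-∑ elements #[ ker? ] _ ⟩
    #[ ker? ] * #[ inF? ]                              ≤⟨ ℕ.*-monoˡ-≤ #[ inF? ] #ker≤q ⟩
    q * #[ inF? ]                                      ∎))
    where open ℕ.≤-Reasoning

  1-when-inF≡[0]+[F×] : ∀ t → 1 when inF? t ≡ 1 when (t ≟ 0#) ℕ.+ 1 when inF×? t
  1-when-inF≡[0]+[F×] t with t ≟ 0#
  ... | yes refl = when-yes 1 (inF? 0#) (0^p^ n)
  ... | no  _    = refl

  #F≡1+#F× : #[ inF? ] ≡ suc #[ inF×? ]
  #F≡1+#F× = trans (∑-cong elements 1-when-inF≡[0]+[F×])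
                   (trans (∑-distrib elements _ _) (cong (ℕ._+ #[ inF×? ]) (∑-when-≡ᴸ 0# (λ _ → 1))))

  #F×≡q-1 : #[ inF×? ] ≡ q-1
  #F×≡q-1 = ℕ.suc-injective (trans (sym #F≡1+#F×) (trans #F≡q q≡1+[q-1]))

  trace-fibre? : ∀ γ t → Dec (t ^ᶠ q ≡ t × absTr p n t ≡ γ)
  trace-fibre? γ t = inF? t ×-dec (absTr p n t ≟ γ)

  trace-root? : ∀ t → Dec (absTr p n t ≡ 0#)
  trace-root? t = absTr p n t ≟ 0#

  -- Tr_{F/𝔽_p} is a polynomial of degree p^(n-1) < q.
  #trace-roots<q : #[ trace-root? ] < q
  #trace-roots<q = begin-strict
    #[ trace-root? ]  ≤⟨ #roots≤ (p ^ m) (traceCoefficients p (suc m))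
                           (λ lead≡0 → 1≢0 (trans (sym (traceCoefficients-leading 1<p m)) lead≡0)) trace-root?
                           (λ x Trx≡0 → trans (eval-trace 1<p m x) (subst (λ k → absTr p k x ≡ 0#) n≡1+m Trx≡0)) ⟩
    p ^ m             <⟨ ℕ.^-monoʳ-< p 1<p (ℕ.n<1+n m) ⟩
    p ^ suc m         ≡⟨ cong (p ^_) (sym n≡1+m) ⟩
    q                 ∎
    where
    open ℕ.≤-Reasoning
    m = n ∸ 1
    n≡1+m : n ≡ suc m
    n≡1+m = trans (sym (ℕ.m∸n+n≡m n≥1)) (ℕ.+-comm m 1)

  ∃F-trace≢0 : ∃ λ t → t ^ᶠ q ≡ t × absTr p n t ≢ 0#
  ∃F-trace≢0 = ∑-1-when≢0⇒∃ nonroot? elements (λ #≡0 → ℕ.<⇒≱ #trace-roots<q (q≤#trace-roots #≡0))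
    where
    open ℕ.≤-Reasoning
    root? : ∀ t → Dec (t ^ᶠ q ≡ t × absTr p n t ≡ 0#)
    root? t = inF? t ×-dec trace-root? t
    nonroot? : ∀ t → Dec (t ^ᶠ q ≡ t × absTr p n t ≢ 0#)
    nonroot? t = inF? t ×-dec ¬? (trace-root? t)
    q≤#trace-roots : #[ nonroot? ] ≡ 0 → q ≤ #[ trace-root? ]
    q≤#trace-roots #≡0 = begin
      q                                   ≡⟨ sym #F≡q ⟩
      #[ inF? ]                           ≡⟨ ∑-cong elements (λ t → 1-when-split (inF? t) (trace-root? t)) ⟩
      ∑ elements (λ t → 1 when root? t ℕ.+ 1 when nonroot? t)
                                          ≡⟨ ∑-distrib elements _ _ ⟩
      #[ root? ] ℕ.+ #[ nonroot? ]        ≡⟨ cong (#[ root? ] ℕ.+_) #≡0 ⟩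
      #[ root? ] ℕ.+ 0                    ≡⟨ ℕ.+-identityʳ _ ⟩
      #[ root? ]                          ≤⟨ ∑-mono-≤ elements (λ t → 1-when-×-dec≤ (inF? t) (trace-root? t)) ⟩
      #[ trace-root? ]                    ∎

  #trace-fibre : Carrier → ℕ
  #trace-fibre γ = #[ trace-fibre? γ ]

  -- Tr_{F/𝔽_p} is 𝔽_p-linear and nonzero, so each γ ∈ 𝔽_p is hit by a translate t₀ + Tr⁻¹(0).
  #trace-fibre-constant : ∀ γ → γ ^ᶠ p ≡ γ → #trace-fibre γ ≡ #trace-fibre 0#
  #trace-fibre-constant γ γ^p≡γ = begin
    #trace-fibre γ
      ≡⟨ sym (∑-translate t₀ _) ⟩
    ∑ elements (λ t → 1 when trace-fibre? γ (t + t₀))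
      ≡⟨ ∑-cong elements (λ t → when-⇔ 1 (trace-fibre? γ (t + t₀)) (trace-fibre? 0# t)
        (mk⇔ (to t) (from t))) ⟩
    #trace-fibre 0#                                        ∎
    where
    open ≡-Reasoning
    t₁ = proj₁ ∃F-trace≢0
    t₁∈F = proj₁ (proj₂ ∃F-trace≢0)
    β≢0 = proj₂ (proj₂ ∃F-trace≢0)
    β = absTr p n t₁
    c = γ · β ⁻¹⟨ β≢0 ⟩
    c^p≡c : c ^ᶠ p ≡ c
    c^p≡c = trans (^-distrib-· γ _ p) (cong₂ _·_ γ^p≡γ (fixed-⁻¹ p β≢0 (absTr^p n t₁ t₁∈F)))
    t₀ = c · t₁
    t₀∈F : t₀ ^ᶠ q ≡ t₀
    t₀∈F = trans (^-distrib-· c t₁ q) (cong₂ _·_ (^p≡⇒^p^≡ c^p≡c n) t₁∈F)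
    Tr-t₀ : absTr p n t₀ ≡ γ
    Tr-t₀ = trans (absTr-· n c^p≡c t₁) (trans (*-assoc _ _ _) (trans (cong (γ ·_) (·-inverseˡ β β≢0)) (*-identityʳ γ)))
    to : ∀ t → (t + t₀) ^ᶠ q ≡ t + t₀ × absTr p n (t + t₀) ≡ γ → t ^ᶠ q ≡ t × absTr p n t ≡ 0#
    to t (t+t₀∈F , Tr[t+t₀]≡γ) =
      +-cancelʳ t₀ _ _ (trans (cong (_+_ (t ^ᶠ q)) (sym t₀∈F)) (trans (sym (^p^-+ n t t₀)) t+t₀∈F)) ,
      +-cancelʳ γ _ _ (trans (cong (_+_ (absTr p n t)) (sym Tr-t₀))
                             (trans (sym (absTr-+ n t t₀)) (trans Tr[t+t₀]≡γ (sym (+-identityˡ γ)))))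
    from : ∀ t → t ^ᶠ q ≡ t × absTr p n t ≡ 0# → (t + t₀) ^ᶠ q ≡ t + t₀ × absTr p n (t + t₀) ≡ γ
    from t (t∈F , Trt≡0) =
      trans (^p^-+ n t t₀) (cong₂ _+_ t∈F t₀∈F) ,
      trans (absTr-+ n t t₀) (trans (cong₂ _+_ Trt≡0 Tr-t₀) (+-identityˡ γ))

  #F×-trace : Carrier → ℕ
  #F×-trace γ = #[ (λ t → inF×? t ×-dec (absTr p n t ≟ γ)) ]

  #trace-fibre≡[Tr0≡γ]+#F×-trace : ∀ γ → #trace-fibre γ ≡ 1 when (absTr p n 0# ≟ γ) ℕ.+ #F×-trace γ
  #trace-fibre≡[Tr0≡γ]+#F×-trace γ = begin
    #trace-fibre γ
      ≡⟨ ∑-cong elements split ⟩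
    ∑ elements (λ t → (1 when (absTr p n t ≟ γ)) when (t ≟ 0#) ℕ.+ 1 when (inF×? t ×-dec (absTr p n t ≟ γ)))
        ≡⟨ ∑-distrib elements _ _ ⟩
    _ ℕ.+ #F×-trace γ
      ≡⟨ cong (ℕ._+ #F×-trace γ) (∑-when-≡ᴸ 0# _) ⟩
    1 when (absTr p n 0# ≟ γ) ℕ.+ #F×-trace γ                                  ∎
    where
    open ≡-Reasoning
    split : ∀ t → 1 when trace-fibre? γ t
                  ≡ (1 when (absTr p n t ≟ γ)) when (t ≟ 0#) ℕ.+ 1 when (inF×? t ×-dec (absTr p n t ≟ γ))
    split t with t ≟ 0#
    ... | yes refl = trans (1-when-×-dec (inF? 0#) Tr0≟γ) (trans (cong (_* 1 when Tr0≟γ) (when-yes 1 (inF? 0#) (0^p^ n)))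
                       (trans (ℕ.*-identityˡ _) (sym (ℕ.+-identityʳ _))))
      where Tr0≟γ = absTr p n 0# ≟ γ
    ... | no  _    = refl

  #F×-trace-constant : ∀ γ → γ ≢ 0# → γ ^ᶠ p ≡ γ → #F×-trace γ ≡ suc (#F×-trace 0#)
  #F×-trace-constant γ γ≢0 γ^p≡γ = begin
    #F×-trace γ
      ≡⟨ cong (ℕ._+ #F×-trace γ) (sym (when-no 1 (absTr p n 0# ≟ γ) Tr0≢γ)) ⟩
    1 when (absTr p n 0# ≟ γ) ℕ.+ #F×-trace γ
      ≡⟨ sym (#trace-fibre≡[Tr0≡γ]+#F×-trace γ) ⟩
    #trace-fibre γ
      ≡⟨ #trace-fibre-constant γ γ^p≡γ ⟩
    #trace-fibre 0#
      ≡⟨ #trace-fibre≡[Tr0≡γ]+#F×-trace 0# ⟩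
    1 when (absTr p n 0# ≟ 0#) ℕ.+ #F×-trace 0#
      ≡⟨ cong (ℕ._+ #F×-trace 0#) (when-yes 1 (absTr p n 0# ≟ 0#) (absTr-0 n)) ⟩
    suc (#F×-trace 0#)                               ∎
    where
    open ≡-Reasoning
    Tr0≢γ : absTr p n 0# ≢ γ
    Tr0≢γ Tr0≡γ = γ≢0 (trans (sym Tr0≡γ) (absTr-0 n))

≡1-mod⇒≡1+j* : ∀ {m s} → 2 ≤ m → s ≡ 1 [mod m ] → ∃ λ j → s ≡ suc (j * m)
-- The congruence is divisibility in ℤ: for s = 0 it says m ∣ ∣0 - 1∣ = 1.
≡1-mod⇒≡1+j* {m} {zero}  2≤m m∣1          = ⊥-elim (ℕ.<⇒≱ 2≤m (∣⇒≤ m∣1))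
≡1-mod⇒≡1+j* {m} {suc s} _   (divides j s≡jm) = j , cong suc s≡jm

+a-[+b-+c]≡+d : ∀ {a b c d} → a ℕ.+ c ≡ d ℕ.+ b → + a ℤ.- (+ b ℤ.- + c) ≡ + d
+a-[+b-+c]≡+d {a} {b} {c} {d} a+c≡d+b = begin
  + a ℤ.- (+ b ℤ.- + c)         ≡⟨ rearrange (+ a) (+ b) (+ c) ⟩
  + (a ℕ.+ c) ℤ.- + b           ≡⟨ cong (λ u → + u ℤ.- + b) a+c≡d+b ⟩
  + d ℤ.+ + b ℤ.- + b           ≡⟨ cancel (+ d) (+ b) ⟩
  + d                           ∎
  where
  open ≡-Reasoning
  rearrange : ∀ x y z → x ℤ.- (y ℤ.- z) ≡ (x ℤ.+ z) ℤ.- y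
  rearrange = ℤ-Solver.solve-∀
  cancel : ∀ x y → x ℤ.+ y ℤ.- y ≡ x
  cancel = ℤ-Solver.solve-∀

intᶜ-zero : ∀ {p} {c : Fin p} X → toℕ c ≡ 0 → intᶜ X c ≡ X
intᶜ-zero {c = c} X c≡0 with toℕ c
... | zero  = refl
... | suc _ = ⊥-elim (ℕ.1+n≢0 c≡0)

intᶜ-suc : ∀ {p} {c : Fin p} X {j} → toℕ c ≡ suc j → intᶜ X c ≡ + 0
intᶜ-suc {c = c} X c≡1+j with toℕ c
... | zero  = ⊥-elim (ℕ.0≢1+n c≡1+j)
... | suc _ = refl

module NihoFibres (L : FiniteField) {p n : ℕ} (p-prime : Prime p) (p>2 : p > 2) (n≥1 : n ≥ 1)
                  (char-p : FiniteField.HasChar L p) (|L|≡p^2n : FiniteField.order L ≡ p ^ (2 * n))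
                  (s : ℕ) (s≡1 : s ≡ 1 [mod (p ^ n ∸ 1) ]) (a : FiniteField.Carrier L) where
  open FieldProperties L
  open Frobenius L p-prime char-p using (0^p^; absTr-0; absTr-relTr; fromℕ^p)
  open Counting L
  open QuadraticExtension L p-prime p>2 n≥1 char-p |L|≡p^2n
  open ≡-Reasoning

  2≤q-1 : 2 ≤ q-1
  2≤q-1 = ℕ.≤-pred (subst (3 ≤_) q≡1+[q-1] 2<q)

  ^s-fixes-F : ∀ {l} → l ^ᶠ q ≡ l → l ^ᶠ s ≡ l
  ^s-fixes-F {l} l∈F with ≡1-mod⇒≡1+j* {q-1} {s} 2≤q-1 s≡1
  ... | j , s≡1+j[q-1] = trans (cong (l ^ᶠ_) s≡1+j[q-1]) (^-periodic q-1 (subst (λ k → l ^ᶠ k ≡ l) q≡1+[q-1] l∈F) j)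

  z : Carrier → Carrier
  z x = x ^ᶠ s + - (a · x)

  T : Carrier → Carrier
  T x = relTr p n (z x)

  T-· : ∀ {l} → l ^ᶠ q ≡ l → ∀ x → T (l · x) ≡ l · T x
  T-· {l} l∈F x = begin
    relTr p n ((l · x) ^ᶠ s + - (a · (l · x)))
      ≡⟨ cong (relTr p n) z-· ⟩
    l · z x + (l · z x) ^ᶠ q
      ≡⟨ cong (_+_ (l · z x)) (trans (^-distrib-· l (z x) q) (cong (_· z x ^ᶠ q) l∈F)) ⟩
    l · z x + l · z x ^ᶠ q
      ≡⟨ sym (distribˡ l (z x) (z x ^ᶠ q)) ⟩
    l · T x                                       ∎
    where
    z-· : (l · x) ^ᶠ s + - (a · (l · x)) ≡ l · z x
    z-· = begin
      (l · x) ^ᶠ s + - (a · (l · x))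
        ≡⟨ cong₂ (λ u v → u + - v) (trans (^-distrib-· l x s) (cong (_· x ^ᶠ s) (^s-fixes-F l∈F)))
          (solve 3 (λ a l x → a :* (l :* x) := l :* (a :* x)) refl a l x) ⟩
      l · x ^ᶠ s + - (l · (a · x))
        ≡⟨ cong (_+_ (l · x ^ᶠ s)) (-‿distribʳ-* l (a · x)) ⟩
      l · x ^ᶠ s + l · - (a · x)
        ≡⟨ sym (distribˡ l _ _) ⟩
      l · z x                          ∎

  T-0 : T 0# ≡ 0#
  T-0 = begin
    T 0#          ≡⟨ cong T (sym (zeroˡ 0#)) ⟩
    T (0# · 0#)   ≡⟨ T-· (0^p^ n) 0# ⟩
    0# · T 0#     ≡⟨ zeroˡ _ ⟩
    0#            ∎

  N : Carrier → ℕ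
  N = #fibre T

  N-outside-F : ∀ t → ¬ (t ^ᶠ q ≡ t) → N t ≡ 0
  N-outside-F t t∉F = trans (∑-cong elements (λ x → when-no 1 (t ≟ T x)
    (λ t≡Tx → t∉F (trans (cong (_^ᶠ q) t≡Tx) (trans (relTr-inF (z x)) (sym t≡Tx)))))) (∑-ε elements)

  N-F× : ∀ t → t ≢ 0# → t ^ᶠ q ≡ t → N t ≡ N 1#
  N-F× t t≢0 t∈F = begin
    ∑ elements (λ x → 1 when (t ≟ T x))
      ≡⟨ sym (∑-scale t≢0 _) ⟩
    ∑ elements (λ x → 1 when (t ≟ T (t · x)))
      ≡⟨ ∑-cong elements (λ x → when-⇔ 1 (t ≟ T (t · x)) (1# ≟ T x) (mk⇔
        (λ t≡T[tx] → ·-cancelˡ t≢0 (trans (*-identityʳ t) (trans t≡T[tx] (T-· t∈F x))))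
        (λ 1≡Tx → trans (sym (*-identityʳ t)) (trans (cong (t ·_) 1≡Tx) (sym (T-· t∈F x)))))) ⟩
    N 1#                                         ∎

  K? : ∀ x → Dec (x ≢ 0# × T x ≡ 0#)
  K? x = nonzero? x ×-dec (T x ≟ 0#)

  |K| : ℕ
  |K| = length (FiniteField.Kset L p n s a)

  N0≡1+|K| : N 0# ≡ suc |K|
  N0≡1+|K| = begin
    N 0#
      ≡⟨ ∑-cong elements split ⟩
    ∑ elements (λ x → 1 when (x ≟ 0#) ℕ.+ 1 when K? x)
      ≡⟨ ∑-distrib elements _ _ ⟩
    ∑ elements (λ x → 1 when (x ≟ 0#)) ℕ.+ #[ K? ]
      ≡⟨ cong₂ ℕ._+_ (∑-when-≡ᴸ 0# (λ _ → 1)) (∑-1-when≡length-filter K? elements) ⟩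
    suc |K|                                                           ∎
    where
    split : ∀ x → 1 when (0# ≟ T x) ≡ 1 when (x ≟ 0#) ℕ.+ 1 when K? x
    split x with x ≟ 0#
    ... | yes refl = when-yes 1 (0# ≟ T 0#) (sym T-0)
    ... | no  x≢0  = when-⇔ 1 (0# ≟ T x) (¬? (no x≢0) ×-dec (T x ≟ 0#))
                              (mk⇔ (λ 0≡Tx → x≢0 , sym 0≡Tx) (λ (_ , Tx≡0) → sym Tx≡0))

  N≡ : ∀ t → N t ≡ N 0# when (t ≟ 0#) ℕ.+ N 1# * 1 when inF×? t
  N≡ t with t ≟ 0#
  ... | yes refl = sym (trans (cong (N 0# ℕ.+_) (ℕ.*-zeroʳ (N 1#))) (ℕ.+-identityʳ _))
  ... | no  t≢0 with inF? t
  ...   | yes t∈F = trans (N-F× t t≢0 t∈F) (sym (ℕ.*-identityʳ (N 1#)))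
  ...   | no  t∉F = trans (N-outside-F t t∉F) (sym (ℕ.*-zeroʳ (N 1#)))

  ∑-weighted-N : ∀ (w : Carrier → ℕ) →
                 ∑ elements (λ t → w t * N t) ≡ w 0# * N 0# ℕ.+ N 1# * ∑ elements (λ t → w t * 1 when inF×? t)
  ∑-weighted-N w = begin
    ∑ elements (λ t → w t * N t)
      ≡⟨ ∑-cong elements pointwise ⟩
    ∑ elements (λ t → (w t * N 0#) when (t ≟ 0#) ℕ.+ N 1# * (w t * 1 when inF×? t))
      ≡⟨ ∑-distrib elements (λ t → (w t * N 0#) when (t ≟ 0#)) _ ⟩
    ∑ elements (λ t → (w t * N 0#) when (t ≟ 0#)) ℕ.+ ∑ elements (λ t → N 1# * (w t * 1 when inF×? t))
        ≡⟨ cong₂ ℕ._+_ (∑-when-≡ᴸ 0# (λ t → w t * N 0#))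
             (sym (*-distribˡ-∑ elements (N 1#) (λ t → w t * 1 when inF×? t))) ⟩
    w 0# * N 0# ℕ.+ N 1# * ∑ elements (λ t → w t * 1 when inF×? t)                    ∎
    where
    pointwise : ∀ t → w t * N t ≡ (w t * N 0#) when (t ≟ 0#) ℕ.+ N 1# * (w t * 1 when inF×? t)
    pointwise t = trans (cong (w t *_) (N≡ t)) (*-distrib-when (w t) (N 0#) (t ≟ 0#) (N 1#) (1 when inF×? t))

  q*q≡N0+N1*[q-1] : q * q ≡ N 0# ℕ.+ N 1# * q-1
  q*q≡N0+N1*[q-1] = begin
    q * q
      ≡⟨ sym order≡q*q ⟩
    order
      ≡⟨ sym (∑-#fibre≡order T) ⟩
    ∑ elements N
      ≡⟨ ∑-cong elements (λ t → sym (ℕ.*-identityˡ (N t))) ⟩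
    ∑ elements (λ t → 1 * N t)
      ≡⟨ ∑-weighted-N (λ _ → 1) ⟩
    1 * N 0# ℕ.+ N 1# * ∑ elements (λ t → 1 * 1 when inF×? t)
      ≡⟨ cong₂ (λ u v → u ℕ.+ N 1# * v) (ℕ.*-identityˡ (N 0#))
        (trans (∑-cong elements (λ t → ℕ.*-identityˡ _)) #F×≡q-1) ⟩
    N 0# ℕ.+ N 1# * q-1                                         ∎

  |K|+N1*[q-1]≡[q+1]*[q-1] : |K| ℕ.+ N 1# * q-1 ≡ suc q * q-1
  |K|+N1*[q-1]≡[q+1]*[q-1] = ℕ.suc-injective (begin
    suc (|K| ℕ.+ N 1# * q-1)     ≡⟨ cong (ℕ._+ N 1# * q-1) (sym N0≡1+|K|) ⟩
    N 0# ℕ.+ N 1# * q-1          ≡⟨ sym q*q≡N0+N1*[q-1] ⟩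
    q * q                        ≡⟨ cong (λ r → r * r) q≡1+[q-1] ⟩
    suc q-1 * suc q-1            ≡⟨ square q-1 ⟩
    suc (suc (suc q-1) * q-1)    ≡⟨ cong (λ r → suc (suc r * q-1)) (sym q≡1+[q-1]) ⟩
    suc (suc q * q-1)            ∎)
    where
    square : ∀ r → suc r * suc r ≡ suc (suc (suc r) * r)
    square = solve-∀

  N1≤q+1 : N 1# ≤ suc q
  N1≤q+1 = ℕ.*-cancelʳ-≤ (N 1#) (suc q) q-1 {{ℕ.>-nonZero (ℕ.<-≤-trans (s≤s z≤n) 2≤q-1)}}
    (subst (N 1# * q-1 ≤_) |K|+N1*[q-1]≡[q+1]*[q-1] (ℕ.m≤n+m (N 1# * q-1) |K|))

  k : ℕ
  k = suc q ∸ N 1#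

  k+N1≡q+1 : k ℕ.+ N 1# ≡ suc q
  k+N1≡q+1 = ℕ.m∸n+n≡m N1≤q+1

  |K|≡k*[q-1] : |K| ≡ k * q-1
  |K|≡k*[q-1] = begin
    |K|                                    ≡⟨ sym (ℕ.m+n∸n≡m |K| (N 1# * q-1)) ⟩
    |K| ℕ.+ N 1# * q-1 ∸ N 1# * q-1        ≡⟨ cong (_∸ N 1# * q-1) |K|+N1*[q-1]≡[q+1]*[q-1] ⟩
    suc q * q-1 ∸ N 1# * q-1               ≡⟨ sym (ℕ.*-distribʳ-∸ q-1 (suc q) (N 1#)) ⟩
    k * q-1                                ∎

  μ-coefficient : ∀ m x (c : Fin p) → μ L p m x c ≡ + (1 when (absTr p m x ≟ fromℕ (toℕ c)))
  μ-coefficient m x c with absTr p m x ≟ fromℕ (toℕ c)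
  ... | yes _ = refl
  ... | no  _ = refl

  #W : Carrier → ℕ
  #W γ = ∑ elements (λ x → 1 when (absTr p (2 * n) (z x) ≟ γ))

  W-coefficient : ∀ c → W L p n s a c ≡ + #W (fromℕ (toℕ c))
  W-coefficient c = coefficients elements
    where
    coefficients : ∀ xs → foldr (λ x acc → μ L p (2 * n) (z x) +ᶜ acc) 0ᶜ xs c
                          ≡ + ∑ xs (λ x → 1 when (absTr p (2 * n) (z x) ≟ fromℕ (toℕ c)))
    coefficients []       = refl
    coefficients (x ∷ xs) = cong₂ ℤ._+_ (μ-coefficient (2 * n) (z x) c) (coefficients xs)

  -- Tr_{L/𝔽_p} = Tr_{F/𝔽_p} ∘ Tr_{L/F}, so #W γ counts the fibres of T over the trace-γ part of F.
  #W≡ : ∀ γ → #W γ ≡ 1 when (absTr p n 0# ≟ γ) * N 0# ℕ.+ N 1# * #F×-trace γ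
  #W≡ γ = begin
    #W γ
      ≡⟨ ∑-cong elements (λ x → cong (λ u → 1 when (u ≟ γ)) (absTr-relTr n (z x))) ⟩
    ∑ elements (λ x → τ (T x))
      ≡⟨ ∑-fibres τ T ⟩
    ∑ elements (λ t → τ t * N t)
      ≡⟨ ∑-weighted-N τ ⟩
    τ 0# * N 0# ℕ.+ N 1# * ∑ elements (λ t → τ t * 1 when inF×? t)
      ≡⟨ cong (λ u → τ 0# * N 0# ℕ.+ N 1# * u) (∑-cong elements (λ t →
        trans (ℕ.*-comm (τ t) _) (sym (1-when-×-dec (inF×? t) (absTr p n t ≟ γ))))) ⟩
    τ 0# * N 0# ℕ.+ N 1# * #F×-trace γ                                         ∎
    where
    τ : Carrier → ℕ
    τ t = 1 when (absTr p n t ≟ γ)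

  K₀ : ℤ
  K₀ = + (N 1# * suc (#F×-trace 0#))

  #W-0 : + #W 0# ℤ.- (+ (q * k) ℤ.- + q) ≡ K₀
  #W-0 = +a-[+b-+c]≡+d {#W 0#} {q * k} {q} (begin
    #W 0# ℕ.+ q
      ≡⟨ cong (ℕ._+ q) (#W≡ 0#) ⟩
    1 when (absTr p n 0# ≟ 0#) * N 0# ℕ.+ N 1# * S₀ ℕ.+ q
      ≡⟨ cong₂ (λ u v → u * v ℕ.+ N 1# * S₀ ℕ.+ q)
        (when-yes 1 (absTr p n 0# ≟ 0#) (absTr-0 n))
        (trans N0≡1+|K| (cong suc |K|≡k*[q-1])) ⟩
    1 * suc (k * q-1) ℕ.+ N 1# * S₀ ℕ.+ q
      ≡⟨ cong (1 * suc (k * q-1) ℕ.+ N 1# * S₀ ℕ.+_) q≡1+[q-1] ⟩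
    1 * suc (k * q-1) ℕ.+ N 1# * S₀ ℕ.+ suc q-1
      ≡⟨ regroup k q-1 (N 1#) S₀ ⟩
    N 1# * S₀ ℕ.+ k * q-1 ℕ.+ suc (suc q-1)
      ≡⟨ cong (N 1# * S₀ ℕ.+ k * q-1 ℕ.+_) (sym (trans k+N1≡q+1 (cong suc q≡1+[q-1]))) ⟩
    N 1# * S₀ ℕ.+ k * q-1 ℕ.+ (k ℕ.+ N 1#)
      ≡⟨ regroup′ k q-1 (N 1#) S₀ ⟩
    N 1# * suc S₀ ℕ.+ suc q-1 * k
      ≡⟨ cong (λ r → N 1# * suc S₀ ℕ.+ r * k) (sym q≡1+[q-1]) ⟩
    N 1# * suc S₀ ℕ.+ q * k                                           ∎)
    where
    S₀ = #F×-trace 0#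
    regroup : ∀ k r N S → 1 * suc (k * r) ℕ.+ N * S ℕ.+ suc r ≡ N * S ℕ.+ k * r ℕ.+ suc (suc r)
    regroup = solve-∀
    regroup′ : ∀ k r N S → N * S ℕ.+ k * r ℕ.+ (k ℕ.+ N) ≡ N * suc S ℕ.+ suc r * k
    regroup′ = solve-∀

  #W-γ : ∀ γ → γ ≢ 0# → γ ^ᶠ p ≡ γ → + #W γ ℤ.- + 0 ≡ K₀
  #W-γ γ γ≢0 γ^p≡γ = begin
    + #W γ ℤ.+ + 0
      ≡⟨ cong (λ u → + u ℤ.+ + 0) (#W≡ γ) ⟩
    + (1 when (absTr p n 0# ≟ γ) * N 0# ℕ.+ N 1# * #F×-trace γ) ℤ.+ + 0 ≡⟨ cong (λ u → + (u * N 0# ℕ.+ N 1# * #F×-trace γ ℕ.+ 0))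
        (when-no 1 (absTr p n 0# ≟ γ) (λ Tr0≡γ → γ≢0 (trans (sym Tr0≡γ) (absTr-0 n)))) ⟩
    + (N 1# * #F×-trace γ ℕ.+ 0)
      ≡⟨ cong +_ (ℕ.+-identityʳ _) ⟩
    + (N 1# * #F×-trace γ)
      ≡⟨ cong (λ u → + (N 1# * u)) (#F×-trace-constant γ γ≢0 γ^p≡γ) ⟩
    K₀                                                                  ∎

  W≈ : ∀ (c : Fin p) → W L p n s a c ℤ.- intᶜ (+ (q * k) ℤ.- + q) c ≡ K₀
  W≈ c = trans (cong (ℤ._- intᶜ X c) (W-coefficient c)) (by-value (toℕ c) refl (Finₚ.toℕ<n c))
    where
    X = + (q * k) ℤ.- + q
    by-value : ∀ m → toℕ c ≡ m → m < p → + #W (fromℕ m) ℤ.- intᶜ X c ≡ K₀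
    by-value zero    c≡0   _     = trans (cong (λ u → + #W 0# ℤ.- u) (intᶜ-zero X c≡0)) #W-0
    by-value (suc j) c≡1+j 1+j<p = trans (cong (λ u → + #W (fromℕ (suc j)) ℤ.- u) (intᶜ-suc X c≡1+j))
                                         (#W-γ (fromℕ (suc j)) (fromℕ≢0 p-prime char-p 1+j<p) (fromℕ^p (suc j)))

lemma3p1 : (p n : ℕ) → Prime p → p > 2 → n ≥ 1
    → (L : FiniteField)
    → FiniteField.HasChar L p
    → FiniteField.order L ≡ p ^ (2 * n)
    → (s : ℕ)
    → gcd s (p ^ (2 * n) ∸ 1) ≡ 1
    → (∀ (j : ℕ) → ¬ (s ≡ p ^ j [mod (p ^ (2 * n) ∸ 1) ]))
    → s ≡ 1 [mod (p ^ n ∸ 1) ]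
    → (a : FiniteField.Carrier L)
    → ∃ λ (k : ℕ) →
        (length (FiniteField.Kset L p n s a) ≡ k * (p ^ n ∸ 1))
        × (_≈ᶜ_ {p} (W L p n s a) (intᶜ (+ (p ^ n * k) - + (p ^ n))))
lemma3p1 p n p-prime p>2 n≥1 L char-p |L|≡p^2n s _ _ s≡1 a = k , |K|≡k*[q-1] , K₀ , W≈
  where open NihoFibres L p-prime p>2 n≥1 char-p |L|≡p^2n s s≡1 a
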